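{- Let $Q,R\in\mathbb{Z}[y]$ be polynomials with zero constant terms of degrees $d_1,d_2$ with $1\leqslant d_1<d_2$, and let $\vec{P}(x,y)=(x,\ x+Q(y),\ x+R(y),\ x+Q(y)+R(y))$. Let $\vec{v}_3=(0,0,1,1)$. For every integer $i>1$: $\mathcal{P}_{i,j}=\mathbb{R}^4$ for $1\leqslant j\leqslant i$; $\mathcal{P}_{i,j}=\{0\}\times\mathbb{R}\times\mathbb{R}\times\mathbb{R}$ for $i+1\leqslant j\leqslant id_1$; $\mathcal{P}_{i,j}=\{0\}\times\{0\}\times\mathbb{R}\times\mathbb{R}$ for $id_1+1\leqslant j\leqslant (i-1)d_2+d_1$; $\mathcal{P}_{i,j}={\rm Span}\{\vec{v}_3\}$ for $(i-1)d_2+d_1+1\leqslant j\leqslant id_2$; $\mathcal{P}_{i,j}=0$ for $j>id_2$.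
   Context: For a vector $\vec{v}=(v_1,\dots,v_t)$ and $l\in\mathbb{N}$, $\binom{\vec{v}}{l}=(\binom{v_1}{l},\dots,\binom{v_t}{l})$. Write $\binom{\vec{P}(x,y)}{l}=\sum_{a,b\geqslant 0}\vec{b}_{l,a,b}\binom{x}{a}\binom{y}{b}$ with $\vec{b}_{l,a,b}\in\mathbb{Z}^t$ (unique). For $i,j\in\mathbb{N}_+$, $\mathcal{P}_{i,j}$ is the real span of all $\vec{b}_{l,a,b}$ with $1\leqslant l\leqslant i$ and $a+b\geqslant j$.
   Formalization: The spans $\mathcal{P}_{i,j}$ and the subspaces they are compared with are taken over the rationals, as subsets of ℚ^4, instead of real spans in $\mathbb{R}^4$. -}

module Defs where

open import Data.Nat as ℕ using (ℕ; zero; suc; _≤_; _<_)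
open import Data.Nat.Combinatorics using (_C_)
open import Data.Integer as ℤ using (ℤ; +_; -[1+_])
open import Data.Rational as ℚ using (ℚ; 0ℚ)
open import Data.Fin using (Fin)
open import Data.Vec using (Vec; _∷_; []; map; zipWith; replicate; lookup)
open import Data.List using (List)
open import Data.List.Relation.Unary.All using (All)
open import Data.Product using (_×_; _,_; ∃)
open import Data.Sum using (_⊎_)
open import Relation.Binary.PropositionalEquality using (_≡_; _≢_)

sumUpTo : {A : Set} → (A → A → A) → A → ℕ → (ℕ → A) → A
sumUpTo _⊕_ e zero    f = f zero
sumUpTo _⊕_ e (suc N) f = sumUpTo _⊕_ e N f ⊕ f (suc N)

-- generalized binomial coefficient  binom(v,l) = v(v-1)...(v-l+1)/l!  for v ∈ ℤ
-- (for v = -(n+1) < 0 it equals (-1)^l * C(n+l, l))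
binomℤ : ℤ → ℕ → ℤ
binomℤ (+ n)      l = + (n C l)
binomℤ -[1+ n ]   l = (ℤ.- (+ 1)) ℤ.^ l ℤ.* + ((n ℕ.+ l) C l)

binomVec : {t : ℕ} → Vec ℤ t → ℕ → Vec ℤ t
binomVec v l = map (λ z → binomℤ z l) v

-- a polynomial in ℤ[y] given by its coefficient function c (c k = coeff of y^k),
-- of degree d: c d ≢ 0 and c k ≡ 0 for k > d
IsPolyOfDegree : (ℕ → ℤ) → ℕ → Set
IsPolyOfDegree c d = (c d ≢ + 0) × (∀ k → d < k → c k ≡ + 0)

evalPoly : (ℕ → ℤ) → ℕ → ℤ → ℤ
evalPoly c d y = sumUpTo ℤ._+_ (+ 0) d (λ k → c k ℤ.* (y ℤ.^ k))

Pvec : (ℕ → ℤ) → ℕ → (ℕ → ℤ) → ℕ → ℤ → ℤ → Vec ℤ 4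
Pvec Q d₁ R d₂ x y =
  x ∷ x ℤ.+ evalPoly Q d₁ y ∷ x ℤ.+ evalPoly R d₂ y ∷
  x ℤ.+ evalPoly Q d₁ y ℤ.+ evalPoly R d₂ y ∷ []

vAddℤ : {t : ℕ} → Vec ℤ t → Vec ℤ t → Vec ℤ t
vAddℤ = zipWith ℤ._+_

vScaleℤ : {t : ℕ} → ℤ → Vec ℤ t → Vec ℤ t
vScaleℤ c = map (c ℤ.*_)

-- B is the (unique) family of coefficients b_{l,a,b} ∈ ℤ^t with
--   binom(P(x,y), l) = Σ_{a,b ≥ 0} b_{l,a,b} binom(x,a) binom(y,b)   for all x,y ∈ ℤ
-- (finitely many nonzero terms for each l).
IsBinomialExpansion : {t : ℕ} → (ℤ → ℤ → Vec ℤ t) → (ℕ → ℕ → ℕ → Vec ℤ t) → Set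
IsBinomialExpansion {t} P B =
  ∀ l → ∃ λ N →
    (∀ a b → (N < a ⊎ N < b) → B l a b ≡ replicate t (+ 0)) ×
    (∀ x y → binomVec (P x y) l ≡
       sumUpTo vAddℤ (replicate t (+ 0)) N (λ a →
         sumUpTo vAddℤ (replicate t (+ 0)) N (λ b →
           vScaleℤ (binomℤ x a ℤ.* binomℤ y b) (B l a b))))

toℚVec : {t : ℕ} → Vec ℤ t → Vec ℚ t
toℚVec = map (λ z → z ℚ./ 1)

linComb : {t : ℕ} → (ℕ → ℕ → ℕ → Vec ℤ t) → List (ℕ × ℕ × ℕ × ℚ) → Vec ℚ t
linComb {t} B List.[] = replicate t 0ℚ
linComb B ((l , a , b , q) List.∷ cs) =
  zipWith ℚ._+_ (map (q ℚ.*_) (toℚVec (B l a b))) (linComb B cs)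

-- w ∈ 𝒫_{i,j} = span{ b_{l,a,b} : 1 ≤ l ≤ i, a + b ≥ j }
InSpan : {t : ℕ} → (ℕ → ℕ → ℕ → Vec ℤ t) → ℕ → ℕ → Vec ℚ t → Set
InSpan B i j w =
  ∃ λ (cs : List (ℕ × ℕ × ℕ × ℚ)) →
    All (λ { (l , a , b , q) → (1 ≤ l) × (l ≤ i) × (j ≤ a ℕ.+ b) }) cs ×
    (w ≡ linComb B cs)

SpanEquals : {t : ℕ} → (ℕ → ℕ → ℕ → Vec ℤ t) → ℕ → ℕ → (Vec ℚ t → Set) → Set
SpanEquals B i j S = ∀ w → (InSpan B i j w → S w) × (S w → InSpan B i j w)

Whole : Vec ℚ 4 → Set
Whole w = Data.Unit.⊤
  where import Data.Unit

Sub₁ : Vec ℚ 4 → Set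
Sub₁ w = lookup w Fin.zero ≡ 0ℚ
  where import Data.Fin as Fin

Sub₂ : Vec ℚ 4 → Set
Sub₂ w = (lookup w Fin.zero ≡ 0ℚ) × (lookup w (Fin.suc Fin.zero) ≡ 0ℚ)
  where import Data.Fin as Fin

SpanV₃ : Vec ℚ 4 → Set
SpanV₃ w = ∃ λ (c : ℚ) → w ≡ 0ℚ ∷ 0ℚ ∷ c ∷ c ∷ []

Zero : Vec ℚ 4 → Set
Zero w = w ≡ 0ℚ ∷ 0ℚ ∷ 0ℚ ∷ 0ℚ ∷ []

module Submission where

-- For every coordinate k the vector P(x, y) has the form x + u_k(y) with
-- u = (0, Q, R, Q + R).  Newton interpolation in both variables turns the defining
-- identity of b_{l,a,b} into the coefficient formula
--     (b_{l,a,b})_k = Δ^b [ y ↦ binom(u_k(y), l − a) ](0)      (0 if a > l),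
-- where Δ is the forward difference.  A calculus of "difference degrees" (Δ^(D+1) f = 0)
-- with leading coefficients tracked up to positive factors then shows:
-- binom(u, m) has degree m·deg u with nonzero top difference, and
-- binom(Q+R, m) − binom(R, m) has degree d₁ + (m−1)·d₂ with nonzero top difference.
-- Hence each coordinate, and the difference of the last two, vanishes exactly beyond its
-- threshold i, i·d₁, (i−1)·d₂ + d₁, i·d₂, and the generators sitting at the thresholds
-- are nonzero there.  Finally, linear algebra over ℚ turns these vanishing conditions
-- (upper bounds) and threshold generators (lower bounds) into the five descriptions.

open import Defs
open import Data.Nat as ℕ using (ℕ; zero; suc; z≤n; s≤s)
import Data.Nat.Properties as ℕP
import Data.Nat.Tactic.RingSolver as ℕSolver
open import Data.Fin using (Fin; zero; suc)
open import Data.Vec using (Vec; _∷_; []; lookup; replicate)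
import Data.Vec.Properties as Vecₚ
open import Data.Product using (_×_; _,_; ∃; proj₁; proj₂)
open import Data.Sum using (_⊎_; inj₁; inj₂)
open import Data.Empty using (⊥-elim)
open import Data.Unit using (tt)
open import Relation.Nullary using (¬_)
open import Relation.Binary.PropositionalEquality

module DifferenceCalculus where

  open import Data.Nat.Combinatorics using (_C_; nCk+nC[k+1]≡[n+1]C[k+1]; k>n⇒nCk≡0; nCn≡1; nC1≡n; nCk≡nC[n∸k])
  open import Data.Integer as ℤ using (ℤ; +_; -[1+_]; +[1+_]; 0ℤ; 1ℤ; -1ℤ; _+_; _*_; _-_; -_; _^_)
  import Data.Integer.Properties as ℤP
  open import Data.Integer.Tactic.RingSolver using (solve-∀)

  Seq : Set
  Seq = ℕ → ℤ

  Δ : Seq → Seq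
  Δ f n = f (suc n) - f n

  Δ^ : ℕ → Seq → Seq
  Δ^ zero    f = f
  Δ^ (suc k) f = Δ (Δ^ k f)

  Δ^-cong : ∀ {f g} → (∀ n → f n ≡ g n) → ∀ k n → Δ^ k f n ≡ Δ^ k g n
  Δ^-cong f≗g zero    n = f≗g n
  Δ^-cong f≗g (suc k) n = cong₂ _-_ (Δ^-cong f≗g k (suc n)) (Δ^-cong f≗g k n)

  Δ^-suc : ∀ f k n → Δ^ (suc k) f n ≡ Δ^ k (Δ f) n
  Δ^-suc f zero    n = refl
  Δ^-suc f (suc k) n = cong₂ _-_ (Δ^-suc f k (suc n)) (Δ^-suc f k n)

  Δ^-+ : ∀ f g k n → Δ^ k (λ m → f m + g m) n ≡ Δ^ k f n + Δ^ k g n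
  Δ^-+ f g zero    n = refl
  Δ^-+ f g (suc k) n =
    trans (cong₂ _-_ (Δ^-+ f g k (suc n)) (Δ^-+ f g k n))
          (interchange (Δ^ k f (suc n)) (Δ^ k g (suc n)) (Δ^ k f n) (Δ^ k g n))
    where
    interchange : ∀ a b c d → (a + b) - (c + d) ≡ (a - c) + (b - d)
    interchange = solve-∀

  Δ^-- : ∀ f g k n → Δ^ k (λ m → f m - g m) n ≡ Δ^ k f n - Δ^ k g n
  Δ^-- f g zero    n = refl
  Δ^-- f g (suc k) n =
    trans (cong₂ _-_ (Δ^-- f g k (suc n)) (Δ^-- f g k n))
          (interchange (Δ^ k f (suc n)) (Δ^ k g (suc n)) (Δ^ k f n) (Δ^ k g n))
    where
    interchange : ∀ a b c d → (a - b) - (c - d) ≡ (a - c) - (b - d)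
    interchange = solve-∀

  Δ^-scale : ∀ c f k n → Δ^ k (λ m → c * f m) n ≡ c * Δ^ k f n
  Δ^-scale c f zero    n = refl
  Δ^-scale c f (suc k) n =
    trans (cong₂ _-_ (Δ^-scale c f k (suc n)) (Δ^-scale c f k n)) (factor c _ _)
    where
    factor : ∀ c a b → c * a - c * b ≡ c * (a - b)
    factor = solve-∀

  Δ^-shift : ∀ f k n → Δ^ k (λ m → f (suc m)) n ≡ Δ^ k f (suc n)
  Δ^-shift f zero    n = refl
  Δ^-shift f (suc k) n = cong₂ _-_ (Δ^-shift f k (suc n)) (Δ^-shift f k n)

  Δ^-const : ∀ c k n → Δ^ (suc k) (λ _ → c) n ≡ 0ℤ
  Δ^-const c zero    n = ℤP.+-inverseʳ c
  Δ^-const c (suc k) n = cong₂ _-_ (Δ^-const c k (suc n)) (Δ^-const c k n)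

  Δ^-vanishing : ∀ f → (∀ n → f n ≡ 0ℤ) → ∀ k n → Δ^ k f n ≡ 0ℤ
  Δ^-vanishing f f≡0 zero    n = f≡0 n
  Δ^-vanishing f f≡0 (suc k) n = trans (Δ^-cong f≡0 (suc k) n) (Δ^-const 0ℤ k n)

  -- Difference degree.  `HasDegree f D` says Δ^(D+1) f ≡ 0, i.e. f is a polynomial
  -- sequence of degree ≤ D; then Δ^D f is constant, and its value `lead f D` is
  -- D! times the coefficient of n^D.

  HasDegree : Seq → ℕ → Set
  HasDegree f D = ∀ n → Δ^ (suc D) f n ≡ 0ℤ

  lead : Seq → ℕ → ℤ
  lead f D = Δ^ D f 0

  HasDegree-cong : ∀ {f g} D → (∀ n → f n ≡ g n) → HasDegree f D → HasDegree g D
  HasDegree-cong D f≗g deg n = trans (sym (Δ^-cong f≗g (suc D) n)) (deg n)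

  HasDegree-suc : ∀ f D → HasDegree f D → HasDegree f (suc D)
  HasDegree-suc f D deg n = cong₂ _-_ (deg (suc n)) (deg n)

  HasDegree-mono : ∀ f {D E} → D ℕ.≤ E → HasDegree f D → HasDegree f E
  HasDegree-mono f {D} D≤E deg with ℕP.m≤n⇒∃[o]m+o≡n D≤E
  ... | t , refl = raise t
    where
    raise : ∀ t → HasDegree f (D ℕ.+ t)
    raise zero    = subst (HasDegree f) (sym (ℕP.+-identityʳ D)) deg
    raise (suc t) = subst (HasDegree f) (sym (ℕP.+-suc D t)) (HasDegree-suc f (D ℕ.+ t) (raise t))

  HasDegree-Δ : ∀ f D → HasDegree f (suc D) → HasDegree (Δ f) D
  HasDegree-Δ f D deg n = trans (sym (Δ^-suc f (suc D) n)) (deg n)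

  HasDegree-fromΔ : ∀ f D → HasDegree (Δ f) D → HasDegree f (suc D)
  HasDegree-fromΔ f D deg n = trans (Δ^-suc f (suc D) n) (deg n)

  HasDegree-const : ∀ c → HasDegree (λ _ → c) 0
  HasDegree-const c = Δ^-const c 0

  HasDegree-+ : ∀ f g D → HasDegree f D → HasDegree g D → HasDegree (λ m → f m + g m) D
  HasDegree-+ f g D df dg n = trans (Δ^-+ f g (suc D) n) (cong₂ _+_ (df n) (dg n))

  HasDegree-- : ∀ f g D → HasDegree f D → HasDegree g D → HasDegree (λ m → f m - g m) D
  HasDegree-- f g D df dg n = trans (Δ^-- f g (suc D) n) (cong₂ _-_ (df n) (dg n))

  HasDegree-scale : ∀ c f D → HasDegree f D → HasDegree (λ m → c * f m) D
  HasDegree-scale c f D df n =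
    trans (Δ^-scale c f (suc D) n) (trans (cong (c *_) (df n)) (ℤP.*-zeroʳ c))

  HasDegree-shift : ∀ f D → HasDegree f D → HasDegree (λ m → f (suc m)) D
  HasDegree-shift f D df n = trans (Δ^-shift f (suc D) n) (df (suc n))

  HasDegree-unscale : ∀ c f D → ¬ (c ≡ 0ℤ) → HasDegree (λ m → c * f m) D → HasDegree f D
  HasDegree-unscale c f D c≢0 deg n
    with ℤP.i*j≡0⇒i≡0∨j≡0 c (trans (sym (Δ^-scale c f (suc D) n)) (deg n))
  ... | inj₁ c≡0 = ⊥-elim (c≢0 c≡0)
  ... | inj₂ Δ^f≡0 = Δ^f≡0

  Δ^-at-degree : ∀ f D → HasDegree f D → ∀ n → Δ^ D f n ≡ lead f D
  Δ^-at-degree f D deg zero    = refl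
  Δ^-at-degree f D deg (suc n) = trans (ℤP.i-j≡0⇒i≡j _ _ (deg n)) (Δ^-at-degree f D deg n)

  Δ^-above-degree : ∀ f D k → HasDegree f D → D ℕ.< k → ∀ n → Δ^ k f n ≡ 0ℤ
  Δ^-above-degree f D (suc k) deg (s≤s D≤k) = HasDegree-mono f D≤k deg

  -- Positive integers.  Leading coefficients are tracked only up to positive factors,
  -- which is all the nonvanishing arguments below need.

  Positive : ℤ → Set
  Positive x = ∃ λ k → x ≡ +[1+ k ]

  Positive-* : ∀ {a b} → Positive a → Positive b → Positive (a * b)
  Positive-* (k , refl) (l , refl) = _ , refl

  Positive-+ : ∀ {a b} → Positive a → Positive b → Positive (a + b)
  Positive-+ (k , refl) (l , refl) = _ , refl

  Positive-square : ∀ a → ¬ (a ≡ 0ℤ) → Positive (a * a)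
  Positive-square (+ zero)  a≢0 = ⊥-elim (a≢0 refl)
  Positive-square +[1+ n ]  a≢0 = _ , refl
  Positive-square -[1+ n ]  a≢0 = _ , refl

  Positive-cancel : ∀ k a → Positive (+[1+ k ] * a) → Positive a
  Positive-cancel k (+ zero)  (j , e) with () ← trans (sym (ℤP.*-zeroʳ +[1+ k ])) e
  Positive-cancel k +[1+ n ]  _       = n , refl
  Positive-cancel k -[1+ n ]  (j , ())

  Positive⇒≢0 : ∀ {a} → Positive a → ¬ (a ≡ 0ℤ)
  Positive⇒≢0 (k , refl) ()

  Positive-*⇒≢0 : ∀ a b → Positive (a * b) → ¬ (a ≡ 0ℤ)
  Positive-*⇒≢0 a b pos refl = Positive⇒≢0 pos refl

  _·_ : Seq → Seq → Seq
  (f · g) n = f n * g n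

  Δ-· : ∀ f g n → Δ (f · g) n ≡ (Δ f · (λ m → g (suc m))) n + (f · Δ g) n
  Δ-· f g n = leibniz (f (suc n)) (f n) (g (suc n)) (g n)
    where
    leibniz : ∀ a b c d → a * c - b * d ≡ (a - b) * c + b * (c - d)
    leibniz = solve-∀

  PositiveMultiple : ℤ → ℤ → ℤ → Set
  PositiveMultiple t a b = ∃ λ κ → t ≡ +[1+ κ ] * (a * b)

  constant-· : ∀ c g E → HasDegree c 0 → HasDegree g E →
               HasDegree (c · g) E × lead (c · g) E ≡ c 0 * lead g E
  constant-· c g E dc dg =
    HasDegree-cong E scaled≗ (HasDegree-scale (c 0) g E dg) ,
    trans (Δ^-cong (λ n → sym (scaled≗ n)) E 0) (Δ^-scale (c 0) g E 0)
    where
    scaled≗ : ∀ n → c 0 * g n ≡ (c · g) n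
    scaled≗ n = cong (_* g n) (sym (Δ^-at-degree c 0 dc n))

  ·-constant : ∀ f c D → HasDegree f D → HasDegree c 0 →
               HasDegree (f · c) D × lead (f · c) D ≡ lead f D * c 0
  ·-constant f c D df dc with constant-· c f D dc df
  ... | deg , top =
    HasDegree-cong D swap deg ,
    trans (Δ^-cong (λ n → sym (swap n)) D 0) (trans top (ℤP.*-comm (c 0) (lead f D)))
    where
    swap : ∀ n → (c · f) n ≡ (f · c) n
    swap n = ℤP.*-comm (c n) (f n)

  product-degree : ∀ D E f g → HasDegree f D → HasDegree g E →
    HasDegree (f · g) (D ℕ.+ E) × PositiveMultiple (lead (f · g) (D ℕ.+ E)) (lead f D) (lead g E)
  product-degree zero E f g df dg with constant-· f g E df dg
  ... | deg , top = deg , 0 , trans top (sym (ℤP.*-identityˡ _))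
  product-degree (suc D) zero f g df dg with ·-constant f g (suc D) df dg
  ... | deg , top = subst (λ K → HasDegree (f · g) K × PositiveMultiple (lead (f · g) K) (lead f (suc D)) (g 0))
                          (sym (ℕP.+-identityʳ (suc D)))
                          (deg , 0 , trans top (sym (ℤP.*-identityˡ _)))
  product-degree (suc D) (suc E) f g df dg = degree , leading
    where
    g⁺ : Seq
    g⁺ m = g (suc m)
    K : ℕ
    K = suc D ℕ.+ E
    D+1+E≡K : D ℕ.+ suc E ≡ K
    D+1+E≡K = ℕP.+-suc D E
    left : HasDegree (Δ f · g⁺) (D ℕ.+ suc E) ×
           PositiveMultiple (lead (Δ f · g⁺) (D ℕ.+ suc E)) (lead (Δ f) D) (lead g⁺ (suc E))
    left = product-degree D (suc E) (Δ f) g⁺ (HasDegree-Δ f D df) (HasDegree-shift g (suc E) dg)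
    right : HasDegree (f · Δ g) (suc D ℕ.+ E) ×
            PositiveMultiple (lead (f · Δ g) (suc D ℕ.+ E)) (lead f (suc D)) (lead (Δ g) E)
    right = product-degree (suc D) E f (Δ g) df (HasDegree-Δ g E dg)
    degree : HasDegree (f · g) (suc D ℕ.+ suc E)
    degree = subst (HasDegree (f · g)) (sym (cong suc D+1+E≡K))
      (HasDegree-fromΔ (f · g) K (HasDegree-cong K (λ n → sym (Δ-· f g n))
        (HasDegree-+ _ _ K (subst (HasDegree (Δ f · g⁺)) D+1+E≡K (proj₁ left)) (proj₁ right))))
    lead-Δf : lead (Δ f) D ≡ lead f (suc D)
    lead-Δf = sym (Δ^-suc f D 0)
    lead-g⁺ : lead g⁺ (suc E) ≡ lead g (suc E)
    lead-g⁺ = trans (Δ^-shift g (suc E) 0) (Δ^-at-degree g (suc E) dg 1)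
    lead-Δg : lead (Δ g) E ≡ lead g (suc E)
    lead-Δg = sym (Δ^-suc g E 0)
    leading : PositiveMultiple (lead (f · g) (suc D ℕ.+ suc E)) (lead f (suc D)) (lead g (suc E))
    leading with proj₂ left | proj₂ right
    ... | κ₁ , e₁ | κ₂ , e₂ = suc (κ₁ ℕ.+ κ₂) , (begin
        lead (f · g) (suc D ℕ.+ suc E)
          ≡⟨ cong (λ k → lead (f · g) (suc k)) D+1+E≡K ⟩
        lead (f · g) (suc K)
          ≡⟨ Δ^-suc (f · g) K 0 ⟩
        Δ^ K (Δ (f · g)) 0
          ≡⟨ trans (Δ^-cong (Δ-· f g) K 0) (Δ^-+ (Δ f · g⁺) (f · Δ g) K 0) ⟩
        lead (Δ f · g⁺) K + lead (f · Δ g) K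
          ≡⟨ cong₂ _+_ (trans (cong (lead (Δ f · g⁺)) (sym D+1+E≡K)) e₁) e₂ ⟩
        +[1+ κ₁ ] * (lead (Δ f) D * lead g⁺ (suc E)) + +[1+ κ₂ ] * (lead f (suc D) * lead (Δ g) E)
          ≡⟨ cong₂ (λ a b → +[1+ κ₁ ] * a + +[1+ κ₂ ] * b)
                   (cong₂ _*_ lead-Δf lead-g⁺) (cong (lead f (suc D) *_) lead-Δg) ⟩
        +[1+ κ₁ ] * L + +[1+ κ₂ ] * L
          ≡⟨ sym (ℤP.*-distribʳ-+ L +[1+ κ₁ ] +[1+ κ₂ ]) ⟩
        (+[1+ κ₁ ] + +[1+ κ₂ ]) * L
          ≡⟨ cong (λ k → + suc k * L) (ℕP.+-suc κ₁ κ₂) ⟩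
        +[1+ suc (κ₁ ℕ.+ κ₂) ] * L ∎)
      where
      open ≡-Reasoning
      L : ℤ
      L = lead f (suc D) * lead g (suc E)

  nC0≡1 : ∀ n → n C 0 ≡ 1
  nC0≡1 n = trans (nCk≡nC[n∸k] {n = n} z≤n) (nCn≡1 n)

  absorptionℕ : ∀ n k → suc k ℕ.* (suc n C suc k) ≡ suc n ℕ.* (n C k)
  absorptionℕ zero zero = cong (1 ℕ.*_) (trans (nCn≡1 1) (sym (nCn≡1 0)))
  absorptionℕ zero (suc k) =
    trans (cong (suc (suc k) ℕ.*_) (k>n⇒nCk≡0 {n = 1} {k = suc (suc k)} (s≤s (s≤s z≤n))))
          (trans (ℕP.*-zeroʳ (suc (suc k))) (sym (cong (1 ℕ.*_) (k>n⇒nCk≡0 {n = 0} {k = suc k} (s≤s z≤n)))))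
  absorptionℕ (suc n) zero =
    trans (cong (1 ℕ.*_) (nC1≡n (suc (suc n))))
          (trans (ℕP.*-identityˡ (suc (suc n)))
                 (sym (trans (cong (suc (suc n) ℕ.*_) (nC0≡1 (suc n))) (ℕP.*-identityʳ (suc (suc n))))))
  absorptionℕ (suc n) (suc k) = begin
      suc (suc k) ℕ.* (suc (suc n) C suc (suc k))
        ≡⟨ cong (suc (suc k) ℕ.*_) (sym (nCk+nC[k+1]≡[n+1]C[k+1] (suc n) (suc k))) ⟩
      suc (suc k) ℕ.* (X ℕ.+ Y)
        ≡⟨ split (suc k) X Y ⟩
      suc k ℕ.* X ℕ.+ X ℕ.+ suc (suc k) ℕ.* Y
        ≡⟨ cong₂ (λ a b → a ℕ.+ X ℕ.+ b) (absorptionℕ n k) (absorptionℕ n (suc k)) ⟩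
      suc n ℕ.* (n C k) ℕ.+ X ℕ.+ suc n ℕ.* (n C suc k)
        ≡⟨ cong (λ x → suc n ℕ.* (n C k) ℕ.+ x ℕ.+ suc n ℕ.* (n C suc k)) (sym (nCk+nC[k+1]≡[n+1]C[k+1] n k)) ⟩
      suc n ℕ.* (n C k) ℕ.+ (n C k ℕ.+ n C suc k) ℕ.+ suc n ℕ.* (n C suc k)
        ≡⟨ merge (suc n) (n C k) (n C suc k) ⟩
      suc (suc n) ℕ.* (n C k ℕ.+ n C suc k)
        ≡⟨ cong (suc (suc n) ℕ.*_) (nCk+nC[k+1]≡[n+1]C[k+1] n k) ⟩
      suc (suc n) ℕ.* X ∎
    where
    open ≡-Reasoning
    X Y : ℕ
    X = suc n C suc k
    Y = suc n C suc (suc k)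
    split : ∀ a b c → suc a ℕ.* (b ℕ.+ c) ≡ a ℕ.* b ℕ.+ b ℕ.+ suc a ℕ.* c
    split = ℕSolver.solve-∀
    merge : ∀ a b c → a ℕ.* b ℕ.+ (b ℕ.+ c) ℕ.+ a ℕ.* c ≡ suc a ℕ.* (b ℕ.+ c)
    merge = ℕSolver.solve-∀

  binom-0 : ∀ z → binomℤ z 0 ≡ 1ℤ
  binom-0 (+ n)     = cong +_ (nC0≡1 n)
  binom-0 -[1+ n ]  = cong +_ (nC0≡1 (n ℕ.+ 0))

  binom-1 : ∀ z → binomℤ z 1 ≡ z
  binom-1 (+ n)     = cong +_ (nC1≡n n)
  binom-1 -[1+ n ]  = begin
      -1ℤ * 1ℤ * + ((n ℕ.+ 1) C 1) ≡⟨ cong (λ m → -1ℤ * 1ℤ * + m) (nC1≡n (n ℕ.+ 1)) ⟩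
      -1ℤ * 1ℤ * + (n ℕ.+ 1)       ≡⟨ cong (λ m → -1ℤ * 1ℤ * + m) (ℕP.+-comm n 1) ⟩
      -1ℤ * 1ℤ * + suc n           ≡⟨ ℤP.-1*i≡-i (+ suc n) ⟩
      -[1+ n ]                      ∎
    where open ≡-Reasoning

  absorptionℤ : ∀ z m → + suc m * binomℤ z (suc m) ≡ (z - + m) * binomℤ z m
  absorptionℤ (+ zero) zero = refl
  absorptionℤ (+ zero) (suc m) = begin
      + suc (suc m) * + (0 C suc (suc m)) ≡⟨ cong (λ c → + suc (suc m) * + c) (k>n⇒nCk≡0 {n = 0} {k = suc (suc m)} (s≤s z≤n)) ⟩
      + suc (suc m) * 0ℤ                  ≡⟨ ℤP.*-zeroʳ (+ suc (suc m)) ⟩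
      0ℤ                                  ≡⟨ sym (ℤP.*-zeroʳ (0ℤ - + suc m)) ⟩
      (0ℤ - + suc m) * 0ℤ                 ≡⟨ cong (λ c → (0ℤ - + suc m) * + c) (sym (k>n⇒nCk≡0 {n = 0} {k = suc m} (s≤s z≤n))) ⟩
      (0ℤ - + suc m) * + (0 C suc m)      ∎
    where open ≡-Reasoning
  absorptionℤ (+ suc n) zero = begin
      + 1 * + (suc n C 1)          ≡⟨ cong (λ c → + 1 * + c) (nC1≡n (suc n)) ⟩
      + 1 * + suc n                ≡⟨ ℤP.*-comm (+ 1) (+ suc n) ⟩
      + suc n * + 1                ≡⟨ cong₂ (λ a c → a * + c) (sym (ℤP.+-identityʳ (+ suc n))) (sym (nC0≡1 (suc n))) ⟩
      (+ suc n - + 0) * + (suc n C 0) ∎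
    where open ≡-Reasoning
  absorptionℤ (+ suc n) (suc m) = begin
      a' * + (suc n C suc (suc m))
        ≡⟨ sym (ℤP.pos-* (suc (suc m)) (suc n C suc (suc m))) ⟩
      + (suc (suc m) ℕ.* (suc n C suc (suc m)))
        ≡⟨ cong +_ (absorptionℕ n (suc m)) ⟩
      + (suc n ℕ.* (n C suc m))
        ≡⟨ ℤP.pos-* (suc n) (n C suc m) ⟩
      a * d
        ≡⟨ rearrange a b c d ⟩
      (a - b) * (c + d) + (b * (c + d) - a * c)
        ≡⟨ cong (λ t → (a - b) * (c + d) + t) (ℤP.i≡j⇒i-j≡0 bΣ≡ac) ⟩
      (a - b) * (c + d) + 0ℤ
        ≡⟨ trans (ℤP.+-identityʳ _) (cong ((a - b) *_) Σ≡) ⟩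
      (a - b) * + (suc n C suc m) ∎
    where
    open ≡-Reasoning
    a' a b c d : ℤ
    a' = + suc (suc m)
    a = + suc n
    b = + suc m
    c = + (n C m)
    d = + (n C suc m)
    rearrange : ∀ a b c d → a * d ≡ (a - b) * (c + d) + (b * (c + d) - a * c)
    rearrange = solve-∀
    Σ≡ : c + d ≡ + (suc n C suc m)
    Σ≡ = trans (sym (ℤP.pos-+ (n C m) (n C suc m))) (cong +_ (nCk+nC[k+1]≡[n+1]C[k+1] n m))
    bΣ≡ac : b * (c + d) ≡ a * c
    bΣ≡ac = begin
      b * (c + d)                    ≡⟨ cong (b *_) Σ≡ ⟩
      b * + (suc n C suc m)          ≡⟨ sym (ℤP.pos-* (suc m) (suc n C suc m)) ⟩
      + (suc m ℕ.* (suc n C suc m))  ≡⟨ cong +_ (absorptionℕ n m) ⟩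
      + (suc n ℕ.* (n C m))          ≡⟨ ℤP.pos-* (suc n) (n C m) ⟩
      a * c                          ∎
  absorptionℤ -[1+ n ] m = begin
      + suc m * (-1ℤ ^ suc m * + ((n ℕ.+ suc m) C suc m))
        ≡⟨ cong (λ k → + suc m * (-1ℤ ^ suc m * + (k C suc m))) (ℕP.+-suc n m) ⟩
      + suc m * (-1ℤ * s * + (suc N C suc m))
        ≡⟨ pull-sign (+ suc m) s (+ (suc N C suc m)) ⟩
      - (s * (+ suc m * + (suc N C suc m)))
        ≡⟨ cong (λ t → - (s * t)) absorbed ⟩
      - (s * (+ suc N * + (N C m)))
        ≡⟨ push-sign s (+ suc N) (+ (N C m)) ⟩
      - + suc N * (s * + (N C m))
        ≡⟨ cong (_* (s * + (N C m))) minus-suc ⟩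
      (-[1+ n ] - + m) * binomℤ -[1+ n ] m ∎
    where
    open ≡-Reasoning
    N : ℕ
    N = n ℕ.+ m
    s : ℤ
    s = -1ℤ ^ m
    pull-sign : ∀ a s b → a * (-1ℤ * s * b) ≡ - (s * (a * b))
    pull-sign = solve-∀
    push-sign : ∀ s a b → - (s * (a * b)) ≡ - a * (s * b)
    push-sign = solve-∀
    absorbed : + suc m * + (suc N C suc m) ≡ + suc N * + (N C m)
    absorbed = trans (sym (ℤP.pos-* (suc m) (suc N C suc m)))
                     (trans (cong +_ (absorptionℕ N m)) (ℤP.pos-* (suc N) (N C m)))
    minus-suc : - + suc N ≡ -[1+ n ] - + m
    minus-suc = trans (cong -[1+_] (ℕP.+-comm n m)) (sym (ℤP.neg-minus-pos n m))

  pascalℤ : ∀ z m → binomℤ (z + 1ℤ) (suc m) ≡ binomℤ z (suc m) + binomℤ z m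
  pascalℤ (+ n) m = begin
      + ((n ℕ.+ 1) C suc m)            ≡⟨ cong (λ k → + (k C suc m)) (ℕP.+-comm n 1) ⟩
      + (suc n C suc m)                ≡⟨ cong +_ (sym (nCk+nC[k+1]≡[n+1]C[k+1] n m)) ⟩
      + (n C m ℕ.+ n C suc m)          ≡⟨ ℤP.pos-+ (n C m) (n C suc m) ⟩
      + (n C m) + + (n C suc m)        ≡⟨ ℤP.+-comm (+ (n C m)) (+ (n C suc m)) ⟩
      + (n C suc m) + + (n C m)        ∎
    where open ≡-Reasoning
  pascalℤ -[1+ zero ] m = begin
      + (0 C suc m)                    ≡⟨ cong +_ (k>n⇒nCk≡0 {n = 0} {k = suc m} (s≤s z≤n)) ⟩
      0ℤ                               ≡⟨ sym (cancel (-1ℤ ^ m)) ⟩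
      -1ℤ * -1ℤ ^ m * 1ℤ + -1ℤ ^ m * 1ℤ
        ≡⟨ sym (cong₂ (λ a b → -1ℤ * -1ℤ ^ m * + a + -1ℤ ^ m * + b) (nCn≡1 (suc m)) (nCn≡1 m)) ⟩
      -1ℤ ^ suc m * + (suc m C suc m) + -1ℤ ^ m * + (m C m) ∎
    where
    open ≡-Reasoning
    cancel : ∀ s → -1ℤ * s * 1ℤ + s * 1ℤ ≡ 0ℤ
    cancel = solve-∀
  pascalℤ -[1+ suc n ] m = begin
      -1ℤ * s * + ((n ℕ.+ suc m) C suc m)
        ≡⟨ cong (λ k → -1ℤ * s * + (k C suc m)) (ℕP.+-suc n m) ⟩
      -1ℤ * s * + (suc N C suc m)
        ≡⟨ regroup s (+ (suc N C m)) (+ (suc N C suc m)) ⟩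
      -1ℤ * s * (+ (suc N C m) + + (suc N C suc m)) + s * + (suc N C m)
        ≡⟨ cong (λ t → -1ℤ * s * t + s * + (suc N C m)) (sym (ℤP.pos-+ (suc N C m) (suc N C suc m))) ⟩
      -1ℤ * s * + (suc N C m ℕ.+ suc N C suc m) + s * + (suc N C m)
        ≡⟨ cong (λ t → -1ℤ * s * + t + s * + (suc N C m)) (nCk+nC[k+1]≡[n+1]C[k+1] (suc N) m) ⟩
      -1ℤ * s * + (suc (suc N) C suc m) + s * + (suc N C m)
        ≡⟨ cong (λ k → -1ℤ * s * + (suc k C suc m) + s * + (suc N C m)) (sym (ℕP.+-suc n m)) ⟩
      -1ℤ ^ suc m * + ((suc n ℕ.+ suc m) C suc m) + s * + ((suc n ℕ.+ m) C m) ∎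
    where
    open ≡-Reasoning
    N : ℕ
    N = n ℕ.+ m
    s : ℤ
    s = -1ℤ ^ m
    regroup : ∀ s a b → -1ℤ * s * b ≡ -1ℤ * s * (a + b) + s * a
    regroup = solve-∀

  Σℤ : ℕ → (ℕ → ℤ) → ℤ
  Σℤ N f = sumUpTo _+_ 0ℤ N f

  Σℤ-cong : ∀ N {f g : ℕ → ℤ} → (∀ a → f a ≡ g a) → Σℤ N f ≡ Σℤ N g
  Σℤ-cong zero    f≗g = f≗g 0
  Σℤ-cong (suc N) f≗g = cong₂ _+_ (Σℤ-cong N f≗g) (f≗g (suc N))

  Σℤ-*ˡ : ∀ N c (f : ℕ → ℤ) → Σℤ N (λ a → c * f a) ≡ c * Σℤ N f
  Σℤ-*ˡ zero    c f = refl
  Σℤ-*ˡ (suc N) c f = trans (cong (_+ c * f (suc N)) (Σℤ-*ˡ N c f)) (sym (ℤP.*-distribˡ-+ c _ _))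

  Σℤ-vanishing : ∀ N (f : ℕ → ℤ) → (∀ a → f a ≡ 0ℤ) → Σℤ N f ≡ 0ℤ
  Σℤ-vanishing zero    f f≡0 = f≡0 0
  Σℤ-vanishing (suc N) f f≡0 = cong₂ _+_ (Σℤ-vanishing N f f≡0) (f≡0 (suc N))

  Δ^-Σℤ : ∀ N (F : ℕ → Seq) k m → Δ^ k (λ n → Σℤ N (λ a → F a n)) m ≡ Σℤ N (λ a → Δ^ k (F a) m)
  Δ^-Σℤ zero    F k m = refl
  Δ^-Σℤ (suc N) F k m = trans (Δ^-+ (λ n → Σℤ N (λ a → F a n)) (F (suc N)) k m)
                               (cong (_+ Δ^ k (F (suc N)) m) (Δ^-Σℤ N F k m))

  binomΔ : ℕ → ℕ → ℤ → ℤ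
  binomΔ zero    l       w = binomℤ w l
  binomΔ (suc a) zero    w = 0ℤ
  binomΔ (suc a) (suc l) w = binomΔ a l w

  +suc-assoc : ∀ n z → + suc n + z ≡ (+ n + z) + 1ℤ
  +suc-assoc n z = trans (cong (_+ z) (ℤP.pos-+ 1 n)) (move-one (+ n) z)
    where
    move-one : ∀ a b → (1ℤ + a) + b ≡ (a + b) + 1ℤ
    move-one = solve-∀

  Δ-binom : ∀ z l n → Δ (λ x → binomℤ (+ x + z) (suc l)) n ≡ binomℤ (+ n + z) l
  Δ-binom z l n = begin
      binomℤ (+ suc n + z) (suc l) - binomℤ (+ n + z) (suc l)
        ≡⟨ cong (λ w → binomℤ w (suc l) - binomℤ (+ n + z) (suc l)) (+suc-assoc n z) ⟩
      binomℤ ((+ n + z) + 1ℤ) (suc l) - binomℤ (+ n + z) (suc l)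
        ≡⟨ cong (_- binomℤ (+ n + z) (suc l)) (pascalℤ (+ n + z) l) ⟩
      binomℤ (+ n + z) (suc l) + binomℤ (+ n + z) l - binomℤ (+ n + z) (suc l)
        ≡⟨ cancel (binomℤ (+ n + z) (suc l)) (binomℤ (+ n + z) l) ⟩
      binomℤ (+ n + z) l ∎
    where
    open ≡-Reasoning
    cancel : ∀ a b → a + b - a ≡ b
    cancel = solve-∀

  Δ^-binom : ∀ a l z n → Δ^ a (λ x → binomℤ (+ x + z) l) n ≡ binomΔ a l (+ n + z)
  Δ^-binom zero    l       z n = refl
  Δ^-binom (suc a) zero    z n =
    trans (Δ^-suc _ a n) (Δ^-vanishing _ (λ m → cong₂ _-_ (binom-0 (+ suc m + z)) (binom-0 (+ m + z))) a n)
  Δ^-binom (suc a) (suc l) z n =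
    trans (Δ^-suc _ a n) (trans (Δ^-cong (Δ-binom z l) a n) (Δ^-binom a l z n))

  binomΔ-over : ∀ k a w → a ℕ.< k → binomΔ k a w ≡ 0ℤ
  binomΔ-over (suc k) zero    w _         = refl
  binomΔ-over (suc k) (suc a) w (s≤s a<k) = binomΔ-over k a w a<k

  binomΔ-under : ∀ k a w → k ℕ.≤ a → binomΔ k a w ≡ binomℤ w (a ℕ.∸ k)
  binomΔ-under zero    a       w _         = refl
  binomΔ-under (suc k) (suc a) w (s≤s k≤a) = binomΔ-under k a w k≤a

  binomΔ-diagonal : ∀ k → binomΔ k k 0ℤ ≡ 1ℤ
  binomΔ-diagonal k = trans (binomΔ-under k k 0ℤ ℕP.≤-refl) (cong (binomℤ 0ℤ) (ℕP.n∸n≡0 k))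

  binomΔ-offdiagonal : ∀ k a → k ℕ.< a → binomΔ k a 0ℤ ≡ 0ℤ
  binomΔ-offdiagonal k a k<a = trans (binomΔ-under k a 0ℤ (ℕP.<⇒≤ k<a))
    (cong +_ (k>n⇒nCk≡0 {n = 0} {k = a ℕ.∸ k} (ℕP.m<n⇒0<n∸m k<a)))

  Σ-kronecker : ∀ k (c : ℕ → ℤ) N →
    (k ℕ.≤ N → Σℤ N (λ a → binomΔ k a 0ℤ * c a) ≡ c k) ×
    (N ℕ.< k → Σℤ N (λ a → binomΔ k a 0ℤ * c a) ≡ 0ℤ)
  Σ-kronecker zero    c zero = (λ _ → ℤP.*-identityˡ (c 0)) , (λ ())
  Σ-kronecker (suc k) c zero = (λ ()) , (λ _ → refl)
  Σ-kronecker k c (suc N) = inside , outside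
    where
    IH : (k ℕ.≤ N → Σℤ N (λ a → binomΔ k a 0ℤ * c a) ≡ c k) ×
         (N ℕ.< k → Σℤ N (λ a → binomΔ k a 0ℤ * c a) ≡ 0ℤ)
    IH = Σ-kronecker k c N
    inside : k ℕ.≤ suc N → Σℤ (suc N) (λ a → binomΔ k a 0ℤ * c a) ≡ c k
    inside k≤N+1 with ℕP.m≤n⇒m<n∨m≡n k≤N+1
    ... | inj₁ (s≤s k≤N) =
      trans (cong₂ _+_ (proj₁ IH k≤N) (cong (_* c (suc N)) (binomΔ-offdiagonal k (suc N) (s≤s k≤N))))
            (ℤP.+-identityʳ (c k))
    ... | inj₂ refl =
      trans (cong₂ _+_ (proj₂ IH (ℕP.n<1+n N)) (cong (_* c (suc N)) (binomΔ-diagonal (suc N))))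
            (trans (ℤP.+-identityˡ _) (ℤP.*-identityˡ _))
    outside : suc N ℕ.< k → Σℤ (suc N) (λ a → binomΔ k a 0ℤ * c a) ≡ 0ℤ
    outside N+1<k = cong₂ _+_ (proj₂ IH (ℕP.<-trans (ℕP.n<1+n N) N+1<k))
                              (cong (_* c (suc N)) (binomΔ-over k (suc N) 0ℤ N+1<k))

  newton-coefficient : ∀ (f : Seq) (c : ℕ → ℤ) N →
    (∀ n → f n ≡ Σℤ N (λ a → binomℤ (+ n) a * c a)) →
    (∀ a → N ℕ.< a → c a ≡ 0ℤ) → ∀ k → Δ^ k f 0 ≡ c k
  newton-coefficient f c N expansion c-finite k = begin
      Δ^ k f 0
        ≡⟨ Δ^-cong expansion k 0 ⟩
      Δ^ k (λ n → Σℤ N (λ a → binomℤ (+ n) a * c a)) 0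
        ≡⟨ Δ^-Σℤ N (λ a n → binomℤ (+ n) a * c a) k 0 ⟩
      Σℤ N (λ a → Δ^ k (λ n → binomℤ (+ n) a * c a) 0)
        ≡⟨ Σℤ-cong N term ⟩
      Σℤ N (λ a → binomΔ k a 0ℤ * c a)
        ≡⟨ select ⟩
      c k ∎
    where
    open ≡-Reasoning
    term : ∀ a → Δ^ k (λ n → binomℤ (+ n) a * c a) 0 ≡ binomΔ k a 0ℤ * c a
    term a = begin
        Δ^ k (λ n → binomℤ (+ n) a * c a) 0
          ≡⟨ Δ^-cong (λ n → trans (ℤP.*-comm _ (c a)) (cong (λ w → c a * binomℤ w a) (sym (ℤP.+-identityʳ (+ n))))) k 0 ⟩
        Δ^ k (λ n → c a * binomℤ (+ n + 0ℤ) a) 0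
          ≡⟨ Δ^-scale (c a) (λ x → binomℤ (+ x + 0ℤ) a) k 0 ⟩
        c a * Δ^ k (λ x → binomℤ (+ x + 0ℤ) a) 0
          ≡⟨ cong (c a *_) (Δ^-binom k a 0ℤ 0) ⟩
        c a * binomΔ k a 0ℤ
          ≡⟨ ℤP.*-comm (c a) _ ⟩
        binomΔ k a 0ℤ * c a ∎
    select : Σℤ N (λ a → binomΔ k a 0ℤ * c a) ≡ c k
    select with ℕP.≤-<-connex k N
    ... | inj₁ k≤N = proj₁ (Σ-kronecker k c N) k≤N
    ... | inj₂ N<k = trans (proj₂ (Σ-kronecker k c N) N<k) (sym (c-finite k N<k))

  idSeq : Seq
  idSeq n = + n

  Δ-idSeq : ∀ n → Δ idSeq n ≡ 1ℤ
  Δ-idSeq n = trans (cong (_- + n) (ℤP.pos-+ 1 n)) (cancel (+ n))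
    where
    cancel : ∀ a → 1ℤ + a - a ≡ 1ℤ
    cancel = solve-∀

  power : ℕ → Seq
  power k n = (+ n) ^ k

  idSeq-degree : HasDegree idSeq 1
  idSeq-degree n = cong₂ _-_ (Δ-idSeq (suc n)) (Δ-idSeq n)

  power-degree : ∀ k → HasDegree (power k) k × Positive (lead (power k) k)
  power-degree zero = HasDegree-const 1ℤ , 0 , refl
  power-degree (suc k) =
    proj₁ step , subst Positive (sym (proj₂ (proj₂ step))) (Positive-* (proj₁ (proj₂ step) , refl) leads-positive)
    where
    IH : HasDegree (power k) k × Positive (lead (power k) k)
    IH = power-degree k
    step : HasDegree (idSeq · power k) (suc k) ×
           PositiveMultiple (lead (idSeq · power k) (suc k)) (lead idSeq 1) (lead (power k) k)
    step = product-degree 1 k idSeq (power k) idSeq-degree (proj₁ IH)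
    leads-positive : Positive (lead idSeq 1 * lead (power k) k)
    leads-positive = subst Positive (sym (trans (cong (_* lead (power k) k) (Δ-idSeq 0)) (ℤP.*-identityˡ _)))
                           (proj₂ IH)

  polySeq : (ℕ → ℤ) → ℕ → Seq
  polySeq Q d n = evalPoly Q d (+ n)

  polySeq-degree : ∀ Q d → HasDegree (polySeq Q d) d × lead (polySeq Q d) d ≡ Q d * lead (power d) d
  polySeq-degree Q zero = HasDegree-scale (Q 0) (power 0) 0 (proj₁ (power-degree 0)) , refl
  polySeq-degree Q (suc d) =
    HasDegree-+ (polySeq Q d) top (suc d)
      (HasDegree-suc _ d (proj₁ (polySeq-degree Q d)))
      (HasDegree-scale (Q (suc d)) (power (suc d)) (suc d) (proj₁ (power-degree (suc d)))) ,
    trans (Δ^-+ (polySeq Q d) top (suc d) 0)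
          (trans (cong₂ _+_ (proj₁ (polySeq-degree Q d) 0) (Δ^-scale (Q (suc d)) (power (suc d)) (suc d) 0))
                 (ℤP.+-identityˡ _))
    where
    top : Seq
    top n = Q (suc d) * power (suc d) n

  polySeq-lead≢0 : ∀ Q d → ¬ (Q d ≡ 0ℤ) → ¬ (lead (polySeq Q d) d ≡ 0ℤ)
  polySeq-lead≢0 Q d Qd≢0 lead≡0
    with ℤP.i*j≡0⇒i≡0∨j≡0 (Q d) (trans (sym (proj₂ (polySeq-degree Q d))) lead≡0)
  ... | inj₁ Qd≡0 = Qd≢0 Qd≡0
  ... | inj₂ d!≡0 = Positive⇒≢0 (proj₂ (power-degree d)) d!≡0

  _⊖_ : Seq → ℕ → Seq
  (u ⊖ m) n = u n - + m

  ⊖-degree : ∀ u D m → HasDegree u (suc D) → HasDegree (u ⊖ m) (suc D)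
  ⊖-degree u D m du = HasDegree-- u (λ _ → + m) (suc D) du (HasDegree-mono (λ _ → + m) {E = suc D} z≤n (HasDegree-const (+ m)))

  ⊖-lead : ∀ u D m → lead (u ⊖ m) (suc D) ≡ lead u (suc D)
  ⊖-lead u D m = trans (Δ^-- u (λ _ → + m) (suc D) 0)
                       (trans (cong (λ t → lead u (suc D) - t) (Δ^-const (+ m) D 0)) (ℤP.+-identityʳ _))

  binomSeq : Seq → ℕ → Seq
  binomSeq u m n = binomℤ (u n) m

  binomSeq-step : ∀ u m n → (binomSeq u m · (u ⊖ m)) n ≡ + suc m * binomSeq u (suc m) n
  binomSeq-step u m n = trans (ℤP.*-comm (binomℤ (u n) m) ((u ⊖ m) n)) (sym (absorptionℤ (u n) m))

  -- If u has degree D ≥ 1 and leading coefficient T ≠ 0, then binom(u, m) has degree m·D,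
  -- and its leading coefficient has the sign of T^m (in particular it is nonzero).
  binomSeq-degree : ∀ u D → HasDegree u (suc D) → ¬ (lead u (suc D) ≡ 0ℤ) → ∀ m →
    HasDegree (binomSeq u m) (m ℕ.* suc D) ×
    Positive (lead (binomSeq u m) (m ℕ.* suc D) * lead u (suc D) ^ m)
  binomSeq-degree u D du T≢0 zero =
    HasDegree-cong 0 (λ n → sym (binom-0 (u n))) (HasDegree-const 1ℤ) ,
    subst Positive (sym (cong (_* 1ℤ) (binom-0 (u 0)))) (0 , refl)
  binomSeq-degree u D du T≢0 (suc m) = degree , positive
    where
    T : ℤ
    T = lead u (suc D)
    K : ℕ
    K = suc m ℕ.* suc D
    Tm T′ : ℤ
    Tm = lead (binomSeq u m) (m ℕ.* suc D)
    T′ = lead (binomSeq u (suc m)) K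
    IH : HasDegree (binomSeq u m) (m ℕ.* suc D) × Positive (lead (binomSeq u m) (m ℕ.* suc D) * T ^ m)
    IH = binomSeq-degree u D du T≢0 m
    step : HasDegree (binomSeq u m · (u ⊖ m)) (m ℕ.* suc D ℕ.+ suc D) ×
           PositiveMultiple (lead (binomSeq u m · (u ⊖ m)) (m ℕ.* suc D ℕ.+ suc D)) Tm (lead (u ⊖ m) (suc D))
    step = product-degree (m ℕ.* suc D) (suc D) (binomSeq u m) (u ⊖ m) (proj₁ IH) (⊖-degree u D m du)
    K≡ : m ℕ.* suc D ℕ.+ suc D ≡ K
    K≡ = ℕP.+-comm (m ℕ.* suc D) (suc D)
    degree : HasDegree (binomSeq u (suc m)) K
    degree = HasDegree-unscale (+ suc m) (binomSeq u (suc m)) K (λ ())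
      (subst (HasDegree (λ n → + suc m * binomSeq u (suc m) n)) K≡
        (HasDegree-cong (m ℕ.* suc D ℕ.+ suc D) (binomSeq-step u m) (proj₁ step)))
    lead≡ : + suc m * T′ ≡ lead (binomSeq u m · (u ⊖ m)) (m ℕ.* suc D ℕ.+ suc D)
    lead≡ = trans (sym (Δ^-scale (+ suc m) (binomSeq u (suc m)) K 0))
              (trans (cong (λ j → Δ^ j (λ n → + suc m * binomSeq u (suc m) n) 0) (sym K≡))
                     (sym (Δ^-cong (binomSeq-step u m) (m ℕ.* suc D ℕ.+ suc D) 0)))
    κ : ℕ
    κ = proj₁ (proj₂ step)
    E : + suc m * T′ ≡ +[1+ κ ] * (Tm * T)
    E = trans lead≡ (trans (proj₂ (proj₂ step)) (cong (λ z → +[1+ κ ] * (Tm * z)) (⊖-lead u D m)))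
    assoc : ∀ s a t p → s * (a * (t * p)) ≡ (s * a) * (t * p)
    assoc = solve-∀
    regroup : ∀ x a t p → x * (a * t) * (t * p) ≡ x * ((a * p) * (t * t))
    regroup = solve-∀
    regrouped : + suc m * (T′ * T ^ suc m) ≡ +[1+ κ ] * ((Tm * T ^ m) * (T * T))
    regrouped = trans (assoc (+ suc m) T′ T (T ^ m))
                  (trans (cong (λ z → z * (T * T ^ m)) E) (regroup +[1+ κ ] Tm T (T ^ m)))
    positive : Positive (T′ * T ^ suc m)
    positive = Positive-cancel m _ (subst Positive (sym regrouped)
      (Positive-* (κ , refl) (Positive-* (proj₂ IH) (Positive-square T T≢0))))

  +-lower-degree : ∀ q r {D E} → D ℕ.< E → HasDegree q D → HasDegree r E →
    HasDegree (λ n → q n + r n) E × lead (λ n → q n + r n) E ≡ lead r E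
  +-lower-degree q r {D} {E} D<E dq dr =
    HasDegree-+ q r E (HasDegree-mono q (ℕP.<⇒≤ D<E) dq) dr ,
    trans (Δ^-+ q r E 0) (trans (cong (_+ lead r E) (Δ^-above-degree q D E dq D<E 0)) (ℤP.+-identityˡ _))

  -- This is the heart of the computation: the
  -- difference of the last two coordinates drops below the generic degree (m+1)·d₂.
  module BinomialDifference (q r : Seq) (d₁′ d₂′ : ℕ)
    (dq : HasDegree q (suc d₁′)) (dr : HasDegree r (suc d₂′))
    (Tq≢0 : ¬ (lead q (suc d₁′) ≡ 0ℤ)) (Tr≢0 : ¬ (lead r (suc d₂′) ≡ 0ℤ))
    (d₁<d₂ : suc d₁′ ℕ.< suc d₂′) where

    d₁ d₂ : ℕ
    d₁ = suc d₁′
    d₂ = suc d₂′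

    Tq Tr : ℤ
    Tq = lead q d₁
    Tr = lead r d₂

    s : Seq
    s n = q n + r n

    s-degree : HasDegree s d₂
    s-degree = proj₁ (+-lower-degree q r d₁<d₂ dq dr)

    s-lead : lead s d₂ ≡ Tr
    s-lead = proj₂ (+-lower-degree q r d₁<d₂ dq dr)

    Ts≢0 : ¬ (lead s d₂ ≡ 0ℤ)
    Ts≢0 Ts≡0 = Tr≢0 (trans (sym s-lead) Ts≡0)

    binomDiff : ℕ → Seq
    binomDiff m n = binomℤ (s n) m - binomℤ (r n) m

    binomDiff-step : ∀ m n →
      ((r ⊖ m) · binomDiff m) n + (q · binomSeq s m) n ≡ + suc m * binomDiff (suc m) n
    binomDiff-step m n = sym (begin
        + suc m * (binomℤ (s n) (suc m) - binomℤ (r n) (suc m))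
          ≡⟨ distrib (+ suc m) (binomℤ (s n) (suc m)) (binomℤ (r n) (suc m)) ⟩
        + suc m * binomℤ (s n) (suc m) - + suc m * binomℤ (r n) (suc m)
          ≡⟨ cong₂ _-_ (absorptionℤ (s n) m) (absorptionℤ (r n) m) ⟩
        (s n - + m) * binomℤ (s n) m - (r n - + m) * binomℤ (r n) m
          ≡⟨ regroup (q n) (r n) (+ m) (binomℤ (s n) m) (binomℤ (r n) m) ⟩
        (r n - + m) * (binomℤ (s n) m - binomℤ (r n) m) + q n * binomℤ (s n) m ∎)
      where
      open ≡-Reasoning
      distrib : ∀ c a b → c * (a - b) ≡ c * a - c * b
      distrib = solve-∀
      regroup : ∀ q r c a b → (q + r - c) * a - (r - c) * b ≡ (r - c) * (a - b) + q * a
      regroup = solve-∀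

    binomDiff-degree : ∀ m → HasDegree (binomDiff (suc m)) (d₁ ℕ.+ m ℕ.* d₂) ×
                             Positive (lead (binomDiff (suc m)) (d₁ ℕ.+ m ℕ.* d₂) * Tq * Tr ^ m)
    binomDiff-degree zero = degree , positive
      where
      q≗D₁ : ∀ n → q n ≡ binomDiff 1 n
      q≗D₁ n = sym (trans (cong₂ _-_ (binom-1 (s n)) (binom-1 (r n))) (cancel (q n) (r n)))
        where
        cancel : ∀ a b → a + b - b ≡ a
        cancel = solve-∀
      d₁≡ : d₁ ≡ d₁ ℕ.+ 0
      d₁≡ = sym (ℕP.+-identityʳ d₁)
      degree : HasDegree (binomDiff 1) (d₁ ℕ.+ 0)
      degree = subst (HasDegree (binomDiff 1)) d₁≡ (HasDegree-cong d₁ q≗D₁ dq)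
      positive : Positive (lead (binomDiff 1) (d₁ ℕ.+ 0) * Tq * 1ℤ)
      positive = subst Positive
        (cong (λ t → t * Tq * 1ℤ) (trans (Δ^-cong q≗D₁ d₁ 0) (cong (lead (binomDiff 1)) d₁≡)))
        (subst Positive (sym (ℤP.*-identityʳ (Tq * Tq))) (Positive-square Tq Tq≢0))
    binomDiff-degree (suc m′) = degree , positive
      where
      m K : ℕ
      m = suc m′
      K = d₁ ℕ.+ m ℕ.* d₂
      Tm T′ Tsm : ℤ
      Tm  = lead (binomDiff m) (d₁ ℕ.+ m′ ℕ.* d₂)
      T′  = lead (binomDiff (suc m)) K
      Tsm = lead (binomSeq s m) (m ℕ.* d₂)
      IH : HasDegree (binomDiff m) (d₁ ℕ.+ m′ ℕ.* d₂) × Positive (Tm * Tq * Tr ^ m′)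
      IH = binomDiff-degree m′
      fromLower : HasDegree ((r ⊖ m) · binomDiff m) (d₂ ℕ.+ (d₁ ℕ.+ m′ ℕ.* d₂)) ×
                  PositiveMultiple (lead ((r ⊖ m) · binomDiff m) (d₂ ℕ.+ (d₁ ℕ.+ m′ ℕ.* d₂))) (lead (r ⊖ m) d₂) Tm
      fromLower = product-degree d₂ (d₁ ℕ.+ m′ ℕ.* d₂) (r ⊖ m) (binomDiff m) (⊖-degree r d₂′ m dr) (proj₁ IH)
      fromUpper : HasDegree (q · binomSeq s m) K × PositiveMultiple (lead (q · binomSeq s m) K) Tq Tsm
      fromUpper = product-degree d₁ (m ℕ.* d₂) q (binomSeq s m) dq (proj₁ (binomSeq-degree s d₂′ s-degree Ts≢0 m))
      K≡ : d₂ ℕ.+ (d₁ ℕ.+ m′ ℕ.* d₂) ≡ K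
      K≡ = swap d₁ d₂ m′
        where
        swap : ∀ a b c → b ℕ.+ (a ℕ.+ c ℕ.* b) ≡ a ℕ.+ (b ℕ.+ c ℕ.* b)
        swap = ℕSolver.solve-∀
      degree : HasDegree (binomDiff (suc m)) K
      degree = HasDegree-unscale (+ suc m) (binomDiff (suc m)) K (λ ())
        (HasDegree-cong K (binomDiff-step m)
          (HasDegree-+ _ _ K (subst (HasDegree ((r ⊖ m) · binomDiff m)) K≡ (proj₁ fromLower)) (proj₁ fromUpper)))
      lead≡ : + suc m * T′ ≡ lead ((r ⊖ m) · binomDiff m) (d₂ ℕ.+ (d₁ ℕ.+ m′ ℕ.* d₂)) + lead (q · binomSeq s m) K
      lead≡ = trans (sym (Δ^-scale (+ suc m) (binomDiff (suc m)) K 0))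
                (trans (sym (Δ^-cong (binomDiff-step m) K 0))
                  (trans (Δ^-+ ((r ⊖ m) · binomDiff m) (q · binomSeq s m) K 0)
                    (cong (_+ lead (q · binomSeq s m) K) (cong (lead ((r ⊖ m) · binomDiff m)) (sym K≡)))))
      upper-positive : Positive (Tsm * Tr ^ m)
      upper-positive = subst (λ t → Positive (Tsm * t ^ m)) s-lead (proj₂ (binomSeq-degree s d₂′ s-degree Ts≢0 m))
      κ₁ κ₂ : ℕ
      κ₁ = proj₁ (proj₂ fromLower)
      κ₂ = proj₁ (proj₂ fromUpper)
      E : + suc m * T′ ≡ +[1+ κ₁ ] * (Tr * Tm) + +[1+ κ₂ ] * (Tq * Tsm)
      E = trans lead≡ (cong₂ _+_ (trans (proj₂ (proj₂ fromLower)) (cong (λ t → +[1+ κ₁ ] * (t * Tm)) (⊖-lead r d₂′ m)))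
                                 (proj₂ (proj₂ fromUpper)))
      assoc : ∀ s t q r p → s * (t * q * (r * p)) ≡ (s * t) * q * (r * p)
      assoc = solve-∀
      regroup : ∀ x₁ x₂ r h q b p → (x₁ * (r * h) + x₂ * (q * b)) * q * (r * p) ≡
                                    x₁ * ((r * r) * (h * q * p)) + x₂ * ((q * q) * (b * (r * p)))
      regroup = solve-∀
      regrouped : + suc m * (T′ * Tq * Tr ^ suc m′) ≡
                  +[1+ κ₁ ] * ((Tr * Tr) * (Tm * Tq * Tr ^ m′)) + +[1+ κ₂ ] * ((Tq * Tq) * (Tsm * Tr ^ m))
      regrouped = trans (assoc (+ suc m) T′ Tq Tr (Tr ^ m′))
                    (trans (cong (λ z → z * Tq * (Tr * Tr ^ m′)) E) (regroup +[1+ κ₁ ] +[1+ κ₂ ] Tr Tm Tq Tsm (Tr ^ m′)))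
      positive : Positive (T′ * Tq * Tr ^ suc m′)
      positive = Positive-cancel m (T′ * Tq * Tr ^ suc m′) (subst Positive (sym regrouped)
        (Positive-+ (Positive-* (κ₁ , refl) (Positive-* (Positive-square Tr Tr≢0) (proj₂ IH)))
                    (Positive-* (κ₂ , refl) (Positive-* (Positive-square Tq Tq≢0) upper-positive))))

module ExpansionCoefficients where

  open DifferenceCalculus
  open import Data.Integer as ℤ using (ℤ; +_; 0ℤ; 1ℤ; _+_; _*_; _-_)
  import Data.Integer.Properties as ℤP

  lookup-sumUpTo : ∀ {t} N (F : ℕ → Vec ℤ t) k →
    lookup (sumUpTo vAddℤ (replicate t 0ℤ) N F) k ≡ Σℤ N (λ a → lookup (F a) k)
  lookup-sumUpTo zero    F k = refl
  lookup-sumUpTo (suc N) F k =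
    trans (Vecₚ.lookup-zipWith _+_ k (sumUpTo vAddℤ (replicate _ 0ℤ) N F) (F (suc N)))
          (cong (_+ lookup (F (suc N)) k) (lookup-sumUpTo N F k))

  -- Both indices are recovered by Newton interpolation: first in x, then in y.
  coefficient-formula : ∀ {t} (P : ℤ → ℤ → Vec ℤ t) (B : ℕ → ℕ → ℕ → Vec ℤ t) (u : Fin t → Seq) →
    (∀ k x y → lookup (P (+ x) (+ y)) k ≡ + x + u k y) → IsBinomialExpansion P B →
    ∀ l a b k → lookup (B l a b) k ≡ Δ^ b (λ y → binomΔ a l (u k y)) 0
  coefficient-formula {t} P B u P-shape expansion l a b k =
    sym (newton-coefficient (λ y → binomΔ a l (u k y)) (Bₖ a) N in-y (λ b′ N<b′ → Bₖ-finite a b′ (inj₂ N<b′)) b)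
    where
    N : ℕ
    N = proj₁ (expansion l)
    Bₖ : ℕ → ℕ → ℤ
    Bₖ a b = lookup (B l a b) k
    Bₖ-finite : ∀ a b → (N ℕ.< a ⊎ N ℕ.< b) → Bₖ a b ≡ 0ℤ
    Bₖ-finite a b out = trans (cong (λ v → lookup v k) (proj₁ (proj₂ (expansion l)) a b out))
                              (Vecₚ.lookup-replicate k 0ℤ)
    -- the coefficient of binom(x, a) in binom(x + u_k(y), l), for fixed y
    cᵧ : ℕ → ℕ → ℤ
    cᵧ y a = Σℤ N (λ b → binomℤ (+ y) b * Bₖ a b)
    in-x : ∀ x y → binomℤ (+ x + u k y) l ≡ Σℤ N (λ a → binomℤ (+ x) a * cᵧ y a)
    in-x x y = begin
        binomℤ (+ x + u k y) l
          ≡⟨ cong (λ z → binomℤ z l) (sym (P-shape k x y)) ⟩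
        binomℤ (lookup (P (+ x) (+ y)) k) l
          ≡⟨ sym (Vecₚ.lookup-map k (λ z → binomℤ z l) (P (+ x) (+ y))) ⟩
        lookup (binomVec (P (+ x) (+ y)) l) k
          ≡⟨ cong (λ v → lookup v k) (proj₂ (proj₂ (expansion l)) (+ x) (+ y)) ⟩
        lookup (sumUpTo vAddℤ (replicate t 0ℤ) N (λ a → sumUpTo vAddℤ (replicate t 0ℤ) N (λ b →
          vScaleℤ (binomℤ (+ x) a * binomℤ (+ y) b) (B l a b)))) k
          ≡⟨ lookup-sumUpTo N _ k ⟩
        Σℤ N (λ a → lookup (sumUpTo vAddℤ (replicate t 0ℤ) N (λ b →
          vScaleℤ (binomℤ (+ x) a * binomℤ (+ y) b) (B l a b))) k)
          ≡⟨ Σℤ-cong N (λ a → trans (lookup-sumUpTo N _ k) (inner a)) ⟩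
        Σℤ N (λ a → binomℤ (+ x) a * cᵧ y a) ∎
      where
      open ≡-Reasoning
      inner : ∀ a → Σℤ N (λ b → lookup (vScaleℤ (binomℤ (+ x) a * binomℤ (+ y) b) (B l a b)) k)
                  ≡ binomℤ (+ x) a * cᵧ y a
      inner a = trans (Σℤ-cong N (λ b → trans (Vecₚ.lookup-map k _ (B l a b))
                                              (ℤP.*-assoc (binomℤ (+ x) a) (binomℤ (+ y) b) (Bₖ a b))))
                      (Σℤ-*ˡ N (binomℤ (+ x) a) (λ b → binomℤ (+ y) b * Bₖ a b))
    in-y : ∀ y → binomΔ a l (u k y) ≡ Σℤ N (λ b → binomℤ (+ y) b * Bₖ a b)
    in-y y = begin
        binomΔ a l (u k y)
          ≡⟨ cong (binomΔ a l) (sym (ℤP.+-identityˡ (u k y))) ⟩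
        binomΔ a l (0ℤ + u k y)
          ≡⟨ sym (Δ^-binom a l (u k y) 0) ⟩
        Δ^ a (λ x → binomℤ (+ x + u k y) l) 0
          ≡⟨ newton-coefficient (λ x → binomℤ (+ x + u k y) l) (cᵧ y) N (λ x → in-x x y) cᵧ-finite a ⟩
        cᵧ y a ∎
      where
      open ≡-Reasoning
      cᵧ-finite : ∀ a′ → N ℕ.< a′ → cᵧ y a′ ≡ 0ℤ
      cᵧ-finite a′ N<a′ = Σℤ-vanishing N _ (λ b →
        trans (cong (binomℤ (+ y) b *_) (Bₖ-finite a′ b (inj₁ N<a′))) (ℤP.*-zeroʳ (binomℤ (+ y) b)))

  drop-multiple : ∀ c a b D → c ℕ.+ a ℕ.* suc D ℕ.< a ℕ.+ b → c ℕ.< b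
  drop-multiple c a b D h = ℕP.+-cancelʳ-< a c b
    (ℕP.≤-<-trans (ℕP.+-monoʳ-≤ c (ℕP.m≤m*n a (suc D))) (subst (c ℕ.+ a ℕ.* suc D ℕ.<_) (ℕP.+-comm a b) h))

  -- binom(u, m) has degree m·D, so its b-th difference vanishes once b > (l − a)·D;
  -- by the coefficient formula this is the range l·D < a + b.
  coefficient-vanishes : ∀ u D → HasDegree u (suc D) → ¬ (lead u (suc D) ≡ 0ℤ) →
    ∀ l a b → l ℕ.* suc D ℕ.< a ℕ.+ b → Δ^ b (λ y → binomΔ a l (u y)) 0 ≡ 0ℤ
  coefficient-vanishes u D du T≢0 l a b lD<a+b with ℕP.≤-<-connex a l
  ... | inj₂ l<a = Δ^-vanishing _ (λ y → binomΔ-over a l (u y) l<a) b 0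
  ... | inj₁ a≤l = trans (Δ^-cong (λ y → binomΔ-under a l (u y) a≤l) b 0)
    (Δ^-above-degree (binomSeq u (l ℕ.∸ a)) ((l ℕ.∸ a) ℕ.* suc D) b
       (proj₁ (binomSeq-degree u D du T≢0 (l ℕ.∸ a))) below 0)
    where
    below : (l ℕ.∸ a) ℕ.* suc D ℕ.< b
    below = drop-multiple _ a b D (subst (ℕ._< a ℕ.+ b) split lD<a+b)
      where
      split : l ℕ.* suc D ≡ (l ℕ.∸ a) ℕ.* suc D ℕ.+ a ℕ.* suc D
      split = trans (cong (ℕ._* suc D) (sym (ℕP.m∸n+n≡m a≤l))) (ℕP.*-distribʳ-+ (suc D) (l ℕ.∸ a) a)

  module Coordinates (Q R : ℕ → ℤ) (d₁′ d₂′ : ℕ) (B : ℕ → ℕ → ℕ → Vec ℤ 4)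
    (expansion : IsBinomialExpansion (Pvec Q (suc d₁′) R (suc d₂′)) B)
    (Q≢0 : ¬ (Q (suc d₁′) ≡ 0ℤ)) (R≢0 : ¬ (R (suc d₂′) ≡ 0ℤ)) (d₁<d₂ : suc d₁′ ℕ.< suc d₂′) where

    d₁ d₂ : ℕ
    d₁ = suc d₁′
    d₂ = suc d₂′

    q r : Seq
    q = polySeq Q d₁
    r = polySeq R d₂

    q-degree : HasDegree q d₁
    q-degree = proj₁ (polySeq-degree Q d₁)

    r-degree : HasDegree r d₂
    r-degree = proj₁ (polySeq-degree R d₂)

    Tq≢0 : ¬ (lead q d₁ ≡ 0ℤ)
    Tq≢0 = polySeq-lead≢0 Q d₁ Q≢0

    Tr≢0 : ¬ (lead r d₂ ≡ 0ℤ)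
    Tr≢0 = polySeq-lead≢0 R d₂ R≢0

    open BinomialDifference q r d₁′ d₂′ q-degree r-degree Tq≢0 Tr≢0 d₁<d₂
      using (s; s-degree; Ts≢0; binomDiff; binomDiff-degree)

    u : Fin 4 → Seq
    u zero                   _ = 0ℤ
    u (suc zero)             = q
    u (suc (suc zero))       = r
    u (suc (suc (suc zero))) = s

    P-shape : ∀ k x y → lookup (Pvec Q d₁ R d₂ (+ x) (+ y)) k ≡ + x + u k y
    P-shape zero                   x y = sym (ℤP.+-identityʳ (+ x))
    P-shape (suc zero)             x y = refl
    P-shape (suc (suc zero))       x y = refl
    P-shape (suc (suc (suc zero))) x y = ℤP.+-assoc (+ x) (q y) (r y)

    coefficient : ∀ l a b k → lookup (B l a b) k ≡ Δ^ b (λ y → binomΔ a l (u k y)) 0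
    coefficient = coefficient-formula (Pvec Q d₁ R d₂) B u P-shape expansion

    coord₀-vanishes : ∀ l a b → (a ℕ.< l ⊎ l ℕ.< a ⊎ 0 ℕ.< b) → lookup (B l a b) zero ≡ 0ℤ
    coord₀-vanishes l a b off-diagonal = trans (coefficient l a b zero) (vanish off-diagonal)
      where
      vanish : (a ℕ.< l ⊎ l ℕ.< a ⊎ 0 ℕ.< b) → Δ^ b (λ _ → binomΔ a l 0ℤ) 0 ≡ 0ℤ
      vanish (inj₁ a<l)                = Δ^-vanishing _ (λ _ → binomΔ-offdiagonal a l a<l) b 0
      vanish (inj₂ (inj₁ l<a))         = Δ^-vanishing _ (λ _ → binomΔ-over a l 0ℤ l<a) b 0
      vanish (inj₂ (inj₂ (s≤s {n = b′} _))) = Δ^-const (binomΔ a l 0ℤ) b′ 0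

    coord₁-vanishes : ∀ l a b → l ℕ.* d₁ ℕ.< a ℕ.+ b → lookup (B l a b) (suc zero) ≡ 0ℤ
    coord₁-vanishes l a b h = trans (coefficient l a b (suc zero)) (coefficient-vanishes q d₁′ q-degree Tq≢0 l a b h)

    coord₂-vanishes : ∀ l a b → l ℕ.* d₂ ℕ.< a ℕ.+ b → lookup (B l a b) (suc (suc zero)) ≡ 0ℤ
    coord₂-vanishes l a b h = trans (coefficient l a b (suc (suc zero))) (coefficient-vanishes r d₂′ r-degree Tr≢0 l a b h)

    coord₃-vanishes : ∀ l a b → l ℕ.* d₂ ℕ.< a ℕ.+ b → lookup (B l a b) (suc (suc (suc zero))) ≡ 0ℤ
    coord₃-vanishes l a b h = trans (coefficient l a b (suc (suc (suc zero)))) (coefficient-vanishes s d₂′ s-degree Ts≢0 l a b h)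

    -- Above (l−1)·d₂ + d₁ the last two coordinates agree, because binom(s, l−a) − binom(r, l−a)
    -- has degree d₁ + (l−a−1)·d₂ there.
    coord₂≡coord₃ : ∀ l a b → (l ℕ.∸ 1) ℕ.* d₂ ℕ.+ d₁ ℕ.< a ℕ.+ b →
                    lookup (B l a b) (suc (suc zero)) ≡ lookup (B l a b) (suc (suc (suc zero)))
    coord₂≡coord₃ l a b h =
      trans (coefficient l a b (suc (suc zero))) (trans agree (sym (coefficient l a b (suc (suc (suc zero))))))
      where
      agree : Δ^ b (λ y → binomΔ a l (r y)) 0 ≡ Δ^ b (λ y → binomΔ a l (s y)) 0
      agree with ℕP.≤-<-connex a l
      ... | inj₂ l<a = trans (Δ^-vanishing _ (λ y → binomΔ-over a l (r y) l<a) b 0)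
                             (sym (Δ^-vanishing _ (λ y → binomΔ-over a l (s y) l<a) b 0))
      ... | inj₁ a≤l with l ℕ.∸ a in l-a≡
      ...   | zero = Δ^-cong (λ y → trans (lowered r y) (sym (lowered s y))) b 0
        where
        lowered : ∀ v y → binomΔ a l (v y) ≡ 1ℤ
        lowered v y = trans (binomΔ-under a l (v y) a≤l) (trans (cong (binomℤ (v y)) l-a≡) (binom-0 (v y)))
      ...   | suc m = sym (ℤP.i-j≡0⇒i≡j _ _ (begin
          Δ^ b (λ y → binomΔ a l (s y)) 0 - Δ^ b (λ y → binomΔ a l (r y)) 0
            ≡⟨ sym (Δ^-- _ _ b 0) ⟩
          Δ^ b (λ y → binomΔ a l (s y) - binomΔ a l (r y)) 0
            ≡⟨ Δ^-cong (λ y → cong₂ _-_ (lowered s y) (lowered r y)) b 0 ⟩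
          Δ^ b (binomDiff (suc m)) 0
            ≡⟨ Δ^-above-degree (binomDiff (suc m)) (d₁ ℕ.+ m ℕ.* d₂) b (proj₁ (binomDiff-degree m)) below 0 ⟩
          0ℤ ∎))
        where
        open ≡-Reasoning
        lowered : ∀ v y → binomΔ a l (v y) ≡ binomℤ (v y) (suc m)
        lowered v y = trans (binomΔ-under a l (v y) a≤l) (cong (binomℤ (v y)) l-a≡)
        l≡ : l ≡ suc m ℕ.+ a
        l≡ = trans (sym (ℕP.m∸n+n≡m a≤l)) (cong (ℕ._+ a) l-a≡)
        below : d₁ ℕ.+ m ℕ.* d₂ ℕ.< b
        below = drop-multiple _ a b d₂′ (subst (ℕ._< a ℕ.+ b) (reorder m a d₁ d₂)
                  (subst (λ z → (z ℕ.∸ 1) ℕ.* d₂ ℕ.+ d₁ ℕ.< a ℕ.+ b) l≡ h))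
          where
          reorder : ∀ m a c d → (m ℕ.+ a) ℕ.* d ℕ.+ c ≡ c ℕ.+ m ℕ.* d ℕ.+ a ℕ.* d
          reorder = ℕSolver.solve-∀

    diagonal-coefficient : ∀ i k → lookup (B i i 0) k ≡ 1ℤ
    diagonal-coefficient i k = trans (coefficient i i 0 k) (trans (binomΔ-under i i (u k 0) ℕP.≤-refl)
      (trans (cong (binomℤ (u k 0)) (ℕP.n∸n≡0 i)) (binom-0 (u k 0))))

    coord₁-at-threshold : ∀ i → ¬ (lookup (B i 0 (i ℕ.* d₁)) (suc zero) ≡ 0ℤ)
    coord₁-at-threshold i b≡0 = Positive-*⇒≢0 _ _ (proj₂ (binomSeq-degree q d₁′ q-degree Tq≢0 i))
      (trans (sym (coefficient i 0 (i ℕ.* d₁) (suc zero))) b≡0)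

    coord₂-at-threshold : ∀ i → ¬ (lookup (B i 0 (i ℕ.* d₂)) (suc (suc zero)) ≡ 0ℤ)
    coord₂-at-threshold i b≡0 = Positive-*⇒≢0 _ _ (proj₂ (binomSeq-degree r d₂′ r-degree Tr≢0 i))
      (trans (sym (coefficient i 0 (i ℕ.* d₂) (suc (suc zero)))) b≡0)

    coord₂≢coord₃-at-threshold : ∀ m → let β = B (suc m) 0 (m ℕ.* d₂ ℕ.+ d₁) in
      ¬ (lookup β (suc (suc zero)) ≡ lookup β (suc (suc (suc zero))))
    coord₂≢coord₃-at-threshold m equal =
      Positive-*⇒≢0 _ _ (proj₂ (binomDiff-degree m)) (trans (cong (_* lead q d₁) top≡0) (ℤP.*-zeroˡ (lead q d₁)))
      where
      b : ℕ
      b = m ℕ.* d₂ ℕ.+ d₁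
      Δ^b≡0 : Δ^ b (binomDiff (suc m)) 0 ≡ 0ℤ
      Δ^b≡0 = trans (Δ^-- _ _ b 0)
        (trans (cong₂ _-_ (sym (coefficient (suc m) 0 b (suc (suc (suc zero)))))
                          (sym (coefficient (suc m) 0 b (suc (suc zero)))))
               (ℤP.i≡j⇒i-j≡0 (sym equal)))
      top≡0 : lead (binomDiff (suc m)) (d₁ ℕ.+ m ℕ.* d₂) ≡ 0ℤ
      top≡0 = trans (cong (λ j → Δ^ j (binomDiff (suc m)) 0) (ℕP.+-comm d₁ (m ℕ.* d₂))) Δ^b≡0

module Spans where

  open import Data.Integer as ℤ using (ℤ; 0ℤ)
  import Data.Integer.Properties as ℤP
  import Data.Integer.GCD as ℤGCD
  open import Data.Rational as ℚ using (ℚ; 0ℚ; 1ℚ; _+_; _*_; _-_; -_; 1/_; ↥_)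
  import Data.Rational.Properties as ℚP
  open import Data.Rational.Solver using (module +-*-Solver)
  open import Data.Vec using (map; zipWith)
  open import Data.List as List using (List; _++_)
  open import Data.List.Relation.Unary.All as All using (All)
  import Data.List.Relation.Unary.All.Properties as Allₚ

  open +-*-Solver

  toℚ : ℤ → ℚ
  toℚ z = z ℚ./ 1

  toℚ-injective : ∀ {a b} → toℚ a ≡ toℚ b → a ≡ b
  toℚ-injective {a} {b} e = trans (sym (numerator a)) (trans (cong ↥_ e) (numerator b))
    where
    numerator : ∀ z → ↥ (toℚ z) ≡ z
    numerator z = trans (sym (ℤP.*-identityʳ _))
      (trans (cong (↥ (toℚ z) ℤ.*_) (sym (ℤGCD.gcd-zeroʳ z))) (ℚP.↥-/ z 1))

  vec4 : ℚ → ℚ → ℚ → ℚ → Vec ℚ 4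
  vec4 a b c d = a ∷ b ∷ c ∷ d ∷ []

  vec4-cong : ∀ {a₀ a₁ a₂ a₃ b₀ b₁ b₂ b₃} → a₀ ≡ b₀ → a₁ ≡ b₁ → a₂ ≡ b₂ → a₃ ≡ b₃ →
              vec4 a₀ a₁ a₂ a₃ ≡ vec4 b₀ b₁ b₂ b₃
  vec4-cong refl refl refl refl = refl

  vec4-η : ∀ {A : Set} (v : Vec A 4) →
    v ≡ lookup v zero ∷ lookup v (suc zero) ∷ lookup v (suc (suc zero)) ∷ lookup v (suc (suc (suc zero))) ∷ []
  vec4-η (a ∷ b ∷ c ∷ d ∷ []) = refl

  vec4-ext : ∀ (u v : Vec ℚ 4) → (∀ k → lookup u k ≡ lookup v k) → u ≡ v
  vec4-ext u v u≗v = trans (vec4-η u)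
    (trans (vec4-cong (u≗v zero) (u≗v (suc zero)) (u≗v (suc (suc zero))) (u≗v (suc (suc (suc zero)))))
           (sym (vec4-η v)))

  toℚVec-vec4 : ∀ v → toℚVec v ≡ vec4 (toℚ (lookup v zero)) (toℚ (lookup v (suc zero)))
                                       (toℚ (lookup v (suc (suc zero)))) (toℚ (lookup v (suc (suc (suc zero)))))
  toℚVec-vec4 v = cong (map toℚ) (vec4-η v)

  module Span (B : ℕ → ℕ → ℕ → Vec ℤ 4) (i : ℕ) where

    Term : Set
    Term = ℕ × ℕ × ℕ × ℚ

    Admissible : ℕ → Term → Set
    Admissible j (l , a , b , _) = (1 ℕ.≤ l) × (l ℕ.≤ i) × (j ℕ.≤ a ℕ.+ b)

    𝒫 : ℕ → Vec ℚ 4 → Set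
    𝒫 j w = InSpan B i j w

    coordSum : Fin 4 → List Term → ℚ
    coordSum k List.[] = 0ℚ
    coordSum k ((l , a , b , q) List.∷ ts) = q * toℚ (lookup (B l a b) k) + coordSum k ts

    lookup-linComb : ∀ ts k → lookup (linComb B ts) k ≡ coordSum k ts
    lookup-linComb List.[] k = Vecₚ.lookup-replicate k 0ℚ
    lookup-linComb ((l , a , b , q) List.∷ ts) k =
      trans (Vecₚ.lookup-zipWith _+_ k (map (q *_) (toℚVec (B l a b))) (linComb B ts))
        (cong₂ _+_ (trans (Vecₚ.lookup-map k (q *_) (toℚVec (B l a b))) (cong (q *_) (Vecₚ.lookup-map k toℚ (B l a b))))
                   (lookup-linComb ts k))

    coordSum-++ : ∀ k ts us → coordSum k (ts ++ us) ≡ coordSum k ts + coordSum k us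
    coordSum-++ k List.[] us = sym (ℚP.+-identityˡ _)
    coordSum-++ k ((l , a , b , q) List.∷ ts) us =
      trans (cong (q * toℚ (lookup (B l a b) k) +_) (coordSum-++ k ts us))
            (sym (ℚP.+-assoc (q * toℚ (lookup (B l a b) k)) (coordSum k ts) (coordSum k us)))

    scale : ℚ → Term → Term
    scale α (l , a , b , q) = l , a , b , α * q

    coordSum-scale : ∀ k α ts → coordSum k (List.map (scale α) ts) ≡ α * coordSum k ts
    coordSum-scale k α List.[] = sym (ℚP.*-zeroʳ α)
    coordSum-scale k α ((l , a , b , q) List.∷ ts) =
      trans (cong₂ _+_ (ℚP.*-assoc α q _) (coordSum-scale k α ts)) (sym (ℚP.*-distribˡ-+ α _ _))

    𝒫-combine : ∀ j {u v w} α β → 𝒫 j u → 𝒫 j v →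
      w ≡ zipWith _+_ (map (α *_) u) (map (β *_) v) → 𝒫 j w
    𝒫-combine j {u} {v} {w} α β (ts , ts-ok , u≡) (us , us-ok , v≡) w≡ =
      combined , Allₚ.++⁺ (Allₚ.map⁺ ts-ok) (Allₚ.map⁺ us-ok) , vec4-ext w (linComb B combined) coordinates
      where
      open ≡-Reasoning
      combined : List Term
      combined = List.map (scale α) ts ++ List.map (scale β) us
      coordinates : ∀ k → lookup w k ≡ lookup (linComb B combined) k
      coordinates k = begin
        lookup w k
          ≡⟨ cong (λ z → lookup z k) w≡ ⟩
        lookup (zipWith _+_ (map (α *_) u) (map (β *_) v)) k
          ≡⟨ Vecₚ.lookup-zipWith _+_ k (map (α *_) u) (map (β *_) v) ⟩
        lookup (map (α *_) u) k + lookup (map (β *_) v) k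
          ≡⟨ cong₂ _+_ (Vecₚ.lookup-map k (α *_) u) (Vecₚ.lookup-map k (β *_) v) ⟩
        α * lookup u k + β * lookup v k
          ≡⟨ cong₂ (λ x y → α * x + β * y) (trans (cong (λ z → lookup z k) u≡) (lookup-linComb ts k))
                                           (trans (cong (λ z → lookup z k) v≡) (lookup-linComb us k)) ⟩
        α * coordSum k ts + β * coordSum k us
          ≡⟨ sym (cong₂ _+_ (coordSum-scale k α ts) (coordSum-scale k β us)) ⟩
        coordSum k (List.map (scale α) ts) + coordSum k (List.map (scale β) us)
          ≡⟨ sym (coordSum-++ k (List.map (scale α) ts) (List.map (scale β) us)) ⟩
        coordSum k combined
          ≡⟨ sym (lookup-linComb combined k) ⟩
        lookup (linComb B combined) k ∎

    𝒫-zero : ∀ j → 𝒫 j (vec4 0ℚ 0ℚ 0ℚ 0ℚ)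
    𝒫-zero j = List.[] , All.[] , refl

    𝒫-generator : ∀ j l a b → 1 ℕ.≤ l → l ℕ.≤ i → j ℕ.≤ a ℕ.+ b → 𝒫 j (toℚVec (B l a b))
    𝒫-generator j l a b 1≤l l≤i j≤a+b =
      ((l , a , b , 1ℚ) List.∷ List.[]) , ((1≤l , l≤i , j≤a+b) All.∷ All.[]) ,
      vec4-ext _ _ (λ k → trans (Vecₚ.lookup-map k toℚ (B l a b))
        (sym (trans (lookup-linComb ((l , a , b , 1ℚ) List.∷ List.[]) k) (trans (ℚP.+-identityʳ _) (ℚP.*-identityˡ _)))))

    AllGenerators : ℕ → (Vec ℤ 4 → Set) → Set
    AllGenerators j C = ∀ l a b → 1 ℕ.≤ l → l ℕ.≤ i → j ℕ.≤ a ℕ.+ b → C (B l a b)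

    𝒫-coord-zero : ∀ j k → AllGenerators j (λ v → lookup v k ≡ 0ℤ) → ∀ w → 𝒫 j w → lookup w k ≡ 0ℚ
    𝒫-coord-zero j k gens w (ts , ts-ok , w≡) =
      trans (cong (λ z → lookup z k) w≡) (trans (lookup-linComb ts k) (vanish ts ts-ok))
      where
      vanish : ∀ ts → All (Admissible j) ts → coordSum k ts ≡ 0ℚ
      vanish List.[] All.[] = refl
      vanish ((l , a , b , q) List.∷ ts) ((h₁ , h₂ , h₃) All.∷ ok) =
        trans (cong₂ _+_ (trans (cong (λ z → q * toℚ z) (gens l a b h₁ h₂ h₃)) (ℚP.*-zeroʳ q)) (vanish ts ok))
              (ℚP.+-identityʳ 0ℚ)

    𝒫-coord-equal : ∀ j k k′ → AllGenerators j (λ v → lookup v k ≡ lookup v k′) →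
                    ∀ w → 𝒫 j w → lookup w k ≡ lookup w k′
    𝒫-coord-equal j k k′ gens w (ts , ts-ok , w≡) =
      trans (cong (λ z → lookup z k) w≡) (trans (lookup-linComb ts k)
        (trans (agree ts ts-ok) (sym (trans (cong (λ z → lookup z k′) w≡) (lookup-linComb ts k′)))))
      where
      agree : ∀ ts → All (Admissible j) ts → coordSum k ts ≡ coordSum k′ ts
      agree List.[] All.[] = refl
      agree ((l , a , b , q) List.∷ ts) ((h₁ , h₂ , h₃) All.∷ ok) =
        cong₂ _+_ (cong (λ z → q * toℚ z) (gens l a b h₁ h₂ h₃)) (agree ts ok)

  0≡α0+β0 : ∀ α β → 0ℚ ≡ α * 0ℚ + β * 0ℚ
  0≡α0+β0 = solve 2 (λ α β → con 0ℚ := α :* con 0ℚ :+ β :* con 0ℚ) refl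

  α≡α1+β0 : ∀ α β → α ≡ α * 1ℚ + β * 0ℚ
  α≡α1+β0 = solve 2 (λ α β → α := α :* con 1ℚ :+ β :* con 0ℚ) refl

  β≡α0+β1 : ∀ α β → β ≡ α * 0ℚ + β * 1ℚ
  β≡α0+β1 = solve 2 (λ α β → β := α :* con 0ℚ :+ β :* con 1ℚ) refl

  x≡1x+β0 : ∀ x β → x ≡ 1ℚ * x + β * 0ℚ
  x≡1x+β0 = solve 2 (λ x β → x := con 1ℚ :* x :+ β :* con 0ℚ) refl

  module SpanningArguments (B : ℕ → ℕ → ℕ → Vec ℤ 4) (i j : ℕ) where
    open Span B i

    S : Vec ℚ 4 → Set
    S = 𝒫 j

    v₃ e₀ e₁ e₂ e₃ : Vec ℚ 4
    v₃ = vec4 0ℚ 0ℚ 1ℚ 1ℚ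
    e₀ = vec4 1ℚ 0ℚ 0ℚ 0ℚ
    e₁ = vec4 0ℚ 1ℚ 0ℚ 0ℚ
    e₂ = vec4 0ℚ 0ℚ 1ℚ 0ℚ
    e₃ = vec4 0ℚ 0ℚ 0ℚ 1ℚ

    v₃-from : ∀ c → ¬ (c ≡ 0ℚ) → S (vec4 0ℚ 0ℚ c c) → S v₃
    v₃-from c c≢0 s = 𝒫-combine j (1/ c) 0ℚ s s
      (vec4-cong (0≡α0+β0 (1/ c) 0ℚ) (0≡α0+β0 (1/ c) 0ℚ) normalised normalised)
      where
      instance _ = ℚ.≢-nonZero c≢0
      normalised : 1ℚ ≡ 1/ c * c + 0ℚ * c
      normalised = trans (sym (ℚP.*-inverseˡ c)) (solve 2 (λ r c → r :* c := r :* c :+ con 0ℚ :* c) refl (1/ c) c)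

    e₃-from : ∀ e f → ¬ (e ≡ f) → S (vec4 0ℚ 0ℚ e f) → S v₃ → S e₃
    e₃-from e f e≢f s s₃ = 𝒫-combine j ρ β s s₃ (vec4-cong (0≡α0+β0 ρ β) (0≡α0+β0 ρ β) third fourth)
      where
      f-e≢0 : ¬ (f - e ≡ 0ℚ)
      f-e≢0 h = e≢f (sym (trans (solve 2 (λ f e → f := f :- e :+ e) refl f e)
                                 (trans (cong (_+ e) h) (ℚP.+-identityˡ e))))
      instance _ = ℚ.≢-nonZero f-e≢0
      ρ β : ℚ
      ρ = 1/ (f - e)
      β = - (ρ * e)
      third : 0ℚ ≡ ρ * e + β * 1ℚ
      third = solve 2 (λ ρ e → con 0ℚ := ρ :* e :+ (:- (ρ :* e)) :* con 1ℚ) refl ρ e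
      fourth : 1ℚ ≡ ρ * f + β * 1ℚ
      fourth = trans (sym (ℚP.*-inverseˡ (f - e)))
                     (solve 3 (λ ρ e f → ρ :* (f :- e) := ρ :* f :+ (:- (ρ :* e)) :* con 1ℚ) refl ρ e f)

    e₂-from : S v₃ → S e₃ → S e₂
    e₂-from s₃ s₃′ = 𝒫-combine j 1ℚ (- 1ℚ) s₃ s₃′ refl

    e₁-from : ∀ s p p′ → ¬ (s ≡ 0ℚ) → S (vec4 0ℚ s p p′) → S e₂ → S e₃ → S e₁
    e₁-from s p p′ s≢0 u s₂ s₃ = 𝒫-combine j ρ β without-e₂ s₃
      (vec4-cong (0≡α0+β0 ρ β) second (0≡α0+β0 ρ β) fourth)
      where
      without-e₂ : S (vec4 0ℚ s 0ℚ p′)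
      without-e₂ = 𝒫-combine j 1ℚ (- p) u s₂
        (vec4-cong (0≡α0+β0 1ℚ (- p)) (x≡1x+β0 s (- p))
                   (solve 1 (λ p → con 0ℚ := con 1ℚ :* p :+ (:- p) :* con 1ℚ) refl p) (x≡1x+β0 p′ (- p)))
      instance _ = ℚ.≢-nonZero s≢0
      ρ β : ℚ
      ρ = 1/ s
      β = - (ρ * p′)
      second : 1ℚ ≡ ρ * s + β * 0ℚ
      second = trans (sym (ℚP.*-inverseˡ s)) (solve 2 (λ x β → x := x :+ β :* con 0ℚ) refl (ρ * s) β)
      fourth : 0ℚ ≡ ρ * p′ + β * 1ℚ
      fourth = solve 2 (λ ρ p′ → con 0ℚ := ρ :* p′ :+ (:- (ρ :* p′)) :* con 1ℚ) refl ρ p′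

    e₀-from : S (vec4 1ℚ 1ℚ 1ℚ 1ℚ) → S e₁ → S v₃ → S e₀
    e₀-from s₁₁₁₁ s₁ s₃ = 𝒫-combine j 1ℚ (- 1ℚ) (𝒫-combine j 1ℚ (- 1ℚ) s₁₁₁₁ s₁ refl) s₃ refl

    span-whole : S e₀ → S e₁ → S e₂ → S e₃ → ∀ w₀ w₁ w₂ w₃ → S (vec4 w₀ w₁ w₂ w₃)
    span-whole s₀ s₁ s₂ s₃ w₀ w₁ w₂ w₃ = 𝒫-combine j 1ℚ w₃ first-three s₃
      (vec4-cong (x≡1x+β0 w₀ w₃) (x≡1x+β0 w₁ w₃) (x≡1x+β0 w₂ w₃) (β≡α0+β1 1ℚ w₃))
      where
      first-two : S (vec4 w₀ w₁ 0ℚ 0ℚ)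
      first-two = 𝒫-combine j w₀ w₁ s₀ s₁
        (vec4-cong (α≡α1+β0 w₀ w₁) (β≡α0+β1 w₀ w₁) (0≡α0+β0 w₀ w₁) (0≡α0+β0 w₀ w₁))
      first-three : S (vec4 w₀ w₁ w₂ 0ℚ)
      first-three = 𝒫-combine j 1ℚ w₂ first-two s₂
        (vec4-cong (x≡1x+β0 w₀ w₂) (x≡1x+β0 w₁ w₂) (β≡α0+β1 1ℚ w₂) (0≡α0+β0 1ℚ w₂))

    span-last-three : S e₁ → S e₂ → S e₃ → ∀ w₁ w₂ w₃ → S (vec4 0ℚ w₁ w₂ w₃)
    span-last-three s₁ s₂ s₃ w₁ w₂ w₃ = 𝒫-combine j 1ℚ w₃ middle s₃
      (vec4-cong (0≡α0+β0 1ℚ w₃) (x≡1x+β0 w₁ w₃) (x≡1x+β0 w₂ w₃) (β≡α0+β1 1ℚ w₃))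
      where
      middle : S (vec4 0ℚ w₁ w₂ 0ℚ)
      middle = 𝒫-combine j w₁ w₂ s₁ s₂
        (vec4-cong (0≡α0+β0 w₁ w₂) (α≡α1+β0 w₁ w₂) (β≡α0+β1 w₁ w₂) (0≡α0+β0 w₁ w₂))

    span-last-two : S e₂ → S e₃ → ∀ w₂ w₃ → S (vec4 0ℚ 0ℚ w₂ w₃)
    span-last-two s₂ s₃ w₂ w₃ = 𝒫-combine j w₂ w₃ s₂ s₃
      (vec4-cong (0≡α0+β0 w₂ w₃) (0≡α0+β0 w₂ w₃) (α≡α1+β0 w₂ w₃) (β≡α0+β1 w₂ w₃))

    span-v₃ : S v₃ → ∀ c → S (vec4 0ℚ 0ℚ c c)
    span-v₃ s c = 𝒫-combine j c 0ℚ s s (vec4-cong (0≡α0+β0 c 0ℚ) (0≡α0+β0 c 0ℚ) (α≡α1+β0 c 0ℚ) (α≡α1+β0 c 0ℚ))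

open ExpansionCoefficients
open Spans
open import Data.Integer using (ℤ; +_; 0ℤ)

-- The theorem for fixed data, with i = i″ + 2, d₁ = d₁′ + 1 and d₂ = d₂′ + 1.
module Thresholds (Q R : ℕ → ℤ) (d₁′ d₂′ : ℕ) (B : ℕ → ℕ → ℕ → Vec ℤ 4)
  (expansion : IsBinomialExpansion (Pvec Q (suc d₁′) R (suc d₂′)) B)
  (Q≢0 : ¬ (Q (suc d₁′) ≡ + 0)) (R≢0 : ¬ (R (suc d₂′) ≡ + 0)) (d₁<d₂ : suc d₁′ ℕ.< suc d₂′)
  (i″ j : ℕ) where

  open Coordinates Q R d₁′ d₂′ B expansion Q≢0 R≢0 d₁<d₂
  i : ℕ
  i = suc (suc i″)
  open Span B i
  open SpanningArguments B i j

  b₃ : ℕ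
  b₃ = suc i″ ℕ.* d₂ ℕ.+ d₁

  i≤id₁ : i ℕ.≤ i ℕ.* d₁
  i≤id₁ = ℕP.m≤m*n i d₁

  id₁<b₃ : i ℕ.* d₁ ℕ.< b₃
  id₁<b₃ = subst (i ℕ.* d₁ ℕ.<_) (ℕP.+-comm d₁ (suc i″ ℕ.* d₂))
                 (ℕP.+-monoʳ-< d₁ (ℕP.*-monoʳ-< (suc i″) d₁<d₂))

  b₃<id₂ : b₃ ℕ.< i ℕ.* d₂
  b₃<id₂ = subst (b₃ ℕ.<_) (ℕP.+-comm (suc i″ ℕ.* d₂) d₂) (ℕP.+-monoʳ-< (suc i″ ℕ.* d₂) d₁<d₂)

  beyond : ∀ {x y n} → x ℕ.≤ y → y ℕ.< j → j ℕ.≤ n → x ℕ.< n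
  beyond x≤y y<j j≤n = ℕP.≤-<-trans x≤y (ℕP.<-≤-trans y<j j≤n)

  off-diagonal : ∀ l a b → l ℕ.< a ℕ.+ b → a ℕ.< l ⊎ l ℕ.< a ⊎ 0 ℕ.< b
  off-diagonal l a zero    l<a+0 = inj₂ (inj₁ (subst (l ℕ.<_) (ℕP.+-identityʳ a) l<a+0))
  off-diagonal l a (suc b) _     = inj₂ (inj₂ (s≤s z≤n))

  gens-coord₀ : i ℕ.< j → AllGenerators j (λ v → lookup v zero ≡ 0ℤ)
  gens-coord₀ i<j l a b _ l≤i j≤a+b = coord₀-vanishes l a b (off-diagonal l a b (beyond l≤i i<j j≤a+b))

  gens-coord₁ : i ℕ.* d₁ ℕ.< j → AllGenerators j (λ v → lookup v (suc zero) ≡ 0ℤ)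
  gens-coord₁ h l a b _ l≤i j≤a+b = coord₁-vanishes l a b (beyond (ℕP.*-monoˡ-≤ d₁ l≤i) h j≤a+b)

  gens-coord₂ : i ℕ.* d₂ ℕ.< j → AllGenerators j (λ v → lookup v (suc (suc zero)) ≡ 0ℤ)
  gens-coord₂ h l a b _ l≤i j≤a+b = coord₂-vanishes l a b (beyond (ℕP.*-monoˡ-≤ d₂ l≤i) h j≤a+b)

  gens-coord₃ : i ℕ.* d₂ ℕ.< j → AllGenerators j (λ v → lookup v (suc (suc (suc zero))) ≡ 0ℤ)
  gens-coord₃ h l a b _ l≤i j≤a+b = coord₃-vanishes l a b (beyond (ℕP.*-monoˡ-≤ d₂ l≤i) h j≤a+b)

  gens-coord₂₃ : b₃ ℕ.< j → AllGenerators j (λ v → lookup v (suc (suc zero)) ≡ lookup v (suc (suc (suc zero))))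
  gens-coord₂₃ h l a b _ l≤i j≤a+b = coord₂≡coord₃ l a b
    (beyond (ℕP.+-monoˡ-≤ d₁ (ℕP.*-monoˡ-≤ d₂ (ℕP.∸-monoˡ-≤ 1 l≤i))) h j≤a+b)

  -- Lower bounds: the generators b_{i,i,0}, b_{i,0,i·d₁}, b_{i,0,(i−1)·d₂+d₁}, b_{i,0,i·d₂}
  -- lie in 𝒫_{i,j} below the respective thresholds, and together span the claimed spaces.
  generator : ∀ a b → j ℕ.≤ a ℕ.+ b → S (toℚVec (B i a b))
  generator a b = 𝒫-generator j i a b (s≤s z≤n) ℕP.≤-refl

  v₃∈ : j ℕ.≤ i ℕ.* d₂ → S v₃
  v₃∈ h = v₃-from _ (λ c≡0 → coord₂-at-threshold i (toℚ-injective c≡0))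
    (subst S (trans (toℚVec-vec4 (B i 0 (i ℕ.* d₂)))
       (vec4-cong (cong toℚ (coord₀-vanishes i 0 (i ℕ.* d₂) (inj₁ (s≤s z≤n))))
                  (cong toℚ (coord₁-vanishes i 0 (i ℕ.* d₂) (ℕP.<-trans id₁<b₃ b₃<id₂)))
                  refl
                  (cong toℚ (sym (coord₂≡coord₃ i 0 (i ℕ.* d₂) b₃<id₂)))))
       (generator 0 (i ℕ.* d₂) h))

  e₃∈ : j ℕ.≤ b₃ → S e₃
  e₃∈ h = e₃-from _ _ (λ e≡f → coord₂≢coord₃-at-threshold (suc i″) (toℚ-injective e≡f))
    (subst S (trans (toℚVec-vec4 (B i 0 b₃))
       (vec4-cong (cong toℚ (coord₀-vanishes i 0 b₃ (inj₁ (s≤s z≤n))))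
                  (cong toℚ (coord₁-vanishes i 0 b₃ id₁<b₃)) refl refl))
       (generator 0 b₃ h))
    (v₃∈ (ℕP.≤-trans h (ℕP.<⇒≤ b₃<id₂)))

  e₂∈ : j ℕ.≤ b₃ → S e₂
  e₂∈ h = e₂-from (v₃∈ (ℕP.≤-trans h (ℕP.<⇒≤ b₃<id₂))) (e₃∈ h)

  e₁∈ : j ℕ.≤ i ℕ.* d₁ → S e₁
  e₁∈ h = e₁-from _ _ _ (λ s≡0 → coord₁-at-threshold i (toℚ-injective s≡0))
    (subst S (trans (toℚVec-vec4 (B i 0 (i ℕ.* d₁)))
       (vec4-cong (cong toℚ (coord₀-vanishes i 0 (i ℕ.* d₁) (inj₁ (s≤s z≤n)))) refl refl refl))
       (generator 0 (i ℕ.* d₁) h))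
    (e₂∈ h′) (e₃∈ h′)
    where h′ = ℕP.≤-trans h (ℕP.<⇒≤ id₁<b₃)

  e₀∈ : j ℕ.≤ i → S e₀
  e₀∈ h = e₀-from
    (subst S (trans (toℚVec-vec4 (B i i 0))
       (vec4-cong (cong toℚ (diagonal-coefficient i zero)) (cong toℚ (diagonal-coefficient i (suc zero)))
                  (cong toℚ (diagonal-coefficient i (suc (suc zero)))) (cong toℚ (diagonal-coefficient i (suc (suc (suc zero)))))))
       (generator i 0 (subst (j ℕ.≤_) (sym (ℕP.+-identityʳ i)) h)))
    (e₁∈ (ℕP.≤-trans h i≤id₁))
    (v₃∈ (ℕP.≤-trans h (ℕP.≤-trans i≤id₁ (ℕP.<⇒≤ (ℕP.<-trans id₁<b₃ b₃<id₂)))))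

  w≡ : ∀ w → w ≡ vec4 (lookup w zero) (lookup w (suc zero)) (lookup w (suc (suc zero))) (lookup w (suc (suc (suc zero))))
  w≡ = vec4-η

  regime-whole : j ℕ.≤ i → SpanEquals B i j Whole
  regime-whole h w = (λ _ → tt) , λ _ →
    subst S (sym (w≡ w)) (span-whole (e₀∈ h) (e₁∈ h₁) (e₂∈ h₃) (e₃∈ h₃) _ _ _ _)
    where
    h₁ : j ℕ.≤ i ℕ.* d₁
    h₁ = ℕP.≤-trans h i≤id₁
    h₃ : j ℕ.≤ b₃
    h₃ = ℕP.≤-trans h₁ (ℕP.<⇒≤ id₁<b₃)

  regime-Sub₁ : i ℕ.+ 1 ℕ.≤ j → j ℕ.≤ i ℕ.* d₁ → SpanEquals B i j Sub₁
  regime-Sub₁ h h′ w =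
    𝒫-coord-zero j zero (gens-coord₀ i<j) w ,
    λ w₀≡0 → subst S (sym (trans (w≡ w) (vec4-cong w₀≡0 refl refl refl)))
                   (span-last-three (e₁∈ h′) (e₂∈ h₃) (e₃∈ h₃) _ _ _)
    where
    i<j : i ℕ.< j
    i<j = subst (ℕ._≤ j) (ℕP.+-comm i 1) h
    h₃ : j ℕ.≤ b₃
    h₃ = ℕP.≤-trans h′ (ℕP.<⇒≤ id₁<b₃)

  regime-Sub₂ : i ℕ.* d₁ ℕ.+ 1 ℕ.≤ j → j ℕ.≤ b₃ → SpanEquals B i j Sub₂
  regime-Sub₂ h h′ w =
    (λ w∈ → 𝒫-coord-zero j zero (gens-coord₀ (ℕP.≤-<-trans i≤id₁ id₁<j)) w w∈ ,
            𝒫-coord-zero j (suc zero) (gens-coord₁ id₁<j) w w∈) ,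
    λ { (w₀≡0 , w₁≡0) → subst S (sym (trans (w≡ w) (vec4-cong w₀≡0 w₁≡0 refl refl)))
                              (span-last-two (e₂∈ h′) (e₃∈ h′) _ _) }
    where
    id₁<j : i ℕ.* d₁ ℕ.< j
    id₁<j = subst (ℕ._≤ j) (ℕP.+-comm (i ℕ.* d₁) 1) h

  regime-V₃ : b₃ ℕ.+ 1 ℕ.≤ j → j ℕ.≤ i ℕ.* d₂ → SpanEquals B i j SpanV₃
  regime-V₃ h h′ w =
    (λ w∈ → lookup w (suc (suc zero)) , trans (w≡ w)
       (vec4-cong (𝒫-coord-zero j zero (gens-coord₀ (ℕP.≤-<-trans i≤id₁ (ℕP.<-trans id₁<b₃ b₃<j))) w w∈)
                  (𝒫-coord-zero j (suc zero) (gens-coord₁ (ℕP.<-trans id₁<b₃ b₃<j)) w w∈)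
                  refl
                  (sym (𝒫-coord-equal j (suc (suc zero)) (suc (suc (suc zero))) (gens-coord₂₃ b₃<j) w w∈)))) ,
    λ { (c , w≡c) → subst S (sym w≡c) (span-v₃ (v₃∈ h′) c) }
    where
    b₃<j : b₃ ℕ.< j
    b₃<j = subst (ℕ._≤ j) (ℕP.+-comm b₃ 1) h

  regime-zero : i ℕ.* d₂ ℕ.< j → SpanEquals B i j Zero
  regime-zero h w =
    (λ w∈ → trans (w≡ w)
       (vec4-cong (𝒫-coord-zero j zero (gens-coord₀ (ℕP.≤-<-trans i≤id₂ h)) w w∈)
                  (𝒫-coord-zero j (suc zero) (gens-coord₁ (ℕP.≤-<-trans (ℕP.<⇒≤ id₁<id₂) h)) w w∈)
                  (𝒫-coord-zero j (suc (suc zero)) (gens-coord₂ h) w w∈)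
                  (𝒫-coord-zero j (suc (suc (suc zero))) (gens-coord₃ h) w w∈))) ,
    λ w≡0 → subst S (sym w≡0) (𝒫-zero j)
    where
    id₁<id₂ : i ℕ.* d₁ ℕ.< i ℕ.* d₂
    id₁<id₂ = ℕP.<-trans id₁<b₃ b₃<id₂
    i≤id₂ : i ℕ.≤ i ℕ.* d₂
    i≤id₂ = ℕP.≤-trans i≤id₁ (ℕP.<⇒≤ id₁<id₂)

open import Data.Nat using (_≤_; _<_; _+_; _*_; _∸_)

-- Lemma 5.1.  After writing d₁ = d₁′ + 1, d₂ = d₂′ + 1 and i = i″ + 2, the five claims are
-- the five regimes above.
lemma5p1 : (Q R : ℕ → ℤ) (d₁ d₂ : ℕ) →
    IsPolyOfDegree Q d₁ → IsPolyOfDegree R d₂ →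
    Q 0 ≡ + 0 → R 0 ≡ + 0 → 1 ≤ d₁ → d₁ < d₂ →
    (B : ℕ → ℕ → ℕ → Vec ℤ 4) →
    IsBinomialExpansion (Pvec Q d₁ R d₂) B →
    (i : ℕ) → 1 < i → (j : ℕ) → 1 ≤ j →
      ((j ≤ i) → SpanEquals B i j Whole) ×
      ((i + 1 ≤ j) → (j ≤ i * d₁) → SpanEquals B i j Sub₁) ×
      ((i * d₁ + 1 ≤ j) → (j ≤ (i ∸ 1) * d₂ + d₁) → SpanEquals B i j Sub₂) ×
      ((((i ∸ 1) * d₂ + d₁ + 1) ≤ j) → (j ≤ i * d₂) → SpanEquals B i j SpanV₃) ×
      ((i * d₂ < j) → SpanEquals B i j Zero)
lemma5p1 Q R (suc d₁′) (suc d₂′) (Q≢0 , _) (R≢0 , _) _ _ (s≤s z≤n) d₁<d₂ B expansion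
         (suc (suc i″)) (s≤s (s≤s z≤n)) j _ =
  regime-whole , regime-Sub₁ , regime-Sub₂ , regime-V₃ , regime-zero
  where open Thresholds Q R d₁′ d₂′ B expansion Q≢0 R≢0 d₁<d₂ i″ j
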